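{- Let $G$ be a graph with $n$ vertices and $m$ edges and let $S$ be an $n \times n$ grid point set. Then for every bijection $\mu$ from the vertex set of $G$ to $S$ (in particular, also when the bijection may be chosen freely), $G$ admits a $\mu$-respecting RAC$_3$ drawing on $S$ within area $O\left((n+m)^2\right)$.
   Context: An $n \times n$ grid point set is a set $S$ of $n$ points with integer coordinates in $\{1,\dots,n\}^2$ such that no two points of $S$ lie on a common horizontal or a common vertical line. A $\mu$-respecting drawing of $G$ on $S$ places each vertex $v$ at $\mu(v)$ and draws each edge as a polygonal chain between its endpoints' points whose bends lie on points with integer coordinates (segments need not be axis-parallel); edges may not overlap and may not pass through points representing other vertices. It is RAC$_3$ if every edge has at most three bends and any two crossing edges cross at a right angle. The area is that of the bounding box of the drawing on the integer grid. -}

module Defs where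

open import Data.Nat using (ℕ; suc) renaming (_≤_ to _≤ℕ_; _<_ to _<ℕ_; _*_ to _*ℕ_; _+_ to _+ℕ_; _^_ to _^ℕ_)
open import Data.Integer using (ℤ; +_; _+_; _-_; _*_; _≤_; _<_; ∣_∣)
open import Data.Fin using (Fin; toℕ)
open import Data.List using (List; []; _∷_; _++_; length; lookup)
open import Data.List.Membership.Propositional using (_∈_)
open import Data.Product using (_×_; _,_; proj₁; proj₂; ∃; Σ)
open import Data.Sum using (_⊎_)
open import Relation.Binary.PropositionalEquality using (_≡_; _≢_)
open import Relation.Nullary using (¬_)
open import Function.Definitions using (Bijective)

Point : Set
Point = ℤ × ℤ

X Y : Point → ℤ
X = proj₁
Y = proj₂

SameEnds : {n : ℕ} → Fin n × Fin n → Fin n × Fin n → Set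
SameEnds (u , v) (u' , v') = (u ≡ u' × v ≡ v') ⊎ (u ≡ v' × v ≡ u')

record Graph (n m : ℕ) : Set where
  field
    ends     : Fin m → Fin n × Fin n
    loopless : ∀ e → proj₁ (ends e) ≢ proj₂ (ends e)
    simple   : ∀ e f → SameEnds (ends e) (ends f) → e ≡ f

open Graph public

Incident : {n m : ℕ} → Graph n m → Fin n → Fin m → Set
Incident G w e = (w ≡ proj₁ (ends G e)) ⊎ (w ≡ proj₂ (ends G e))

IsGridPointSet : (n : ℕ) → (Fin n → Point) → Set
IsGridPointSet n S =
  (∀ i → (+ 1 ≤ X (S i)) × (X (S i) ≤ + n) × (+ 1 ≤ Y (S i)) × (Y (S i) ≤ + n)) ×
  (∀ i j → i ≢ j → (X (S i) ≢ X (S j)) × (Y (S i) ≢ Y (S j)))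

-- The point P (integer) lies on the closed segment pq: d·P = d·p + a·(q − p), 0 ≤ a ≤ d, d > 0
-- (i.e. P = p + (a/d)(q − p) with a/d ∈ [0,1]).
OnSegAt : Point → Point → ℤ → ℤ → Point → Set
OnSegAt p q a d P =
  (+ 0 < d) × (+ 0 ≤ a) × (a ≤ d) ×
  (d * X P ≡ d * X p + a * (X q - X p)) × (d * Y P ≡ d * Y p + a * (Y q - Y p))

-- Segments pq and rs share the (rational) point p + (a/d)(q−p) = r + (b/d)(s−r).
CommonAt : Point → Point → Point → Point → ℤ → ℤ → ℤ → Set
CommonAt p q r s a b d =
  (+ 0 < d) × (+ 0 ≤ a) × (a ≤ d) × (+ 0 ≤ b) × (b ≤ d) ×
  (d * X p + a * (X q - X p) ≡ d * X r + b * (X s - X r)) ×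
  (d * Y p + a * (Y q - Y p) ≡ d * Y r + b * (Y s - Y r))

segs : List Point → List (Point × Point)
segs (p ∷ q ∷ rest) = (p , q) ∷ segs (q ∷ rest)
segs _ = []

dotDir : Point × Point → Point × Point → ℤ
dotDir (p , q) (r , s) = (X q - X p) * (X s - X r) + (Y q - Y p) * (Y s - Y r)

module _ {n m : ℕ} (G : Graph n m) (S : Fin n → Point) (μ : Fin n → Fin n)
         (bends : Fin m → List Point) where

  pos : Fin n → Point
  pos v = S (μ v)

  chain : Fin m → List Point
  chain e = pos (proj₁ (ends G e)) ∷ (bends e ++ (pos (proj₂ (ends G e)) ∷ []))

  edgeSegs : Fin m → List (Point × Point)
  edgeSegs e = segs (chain e)

  record IsRAC3Drawing : Set where
    field
      atMost3Bends : ∀ e → length (bends e) ≤ℕ 3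
      nondegenerate : ∀ e {p q} → (p , q) ∈ edgeSegs e → p ≢ q
      avoidsVertices : ∀ e w → ¬ Incident G w e → ∀ {p q} → (p , q) ∈ edgeSegs e →
                       ∀ a d → ¬ OnSegAt p q a d (pos w)
      -- every edge is a simple polygonal chain (no self-overlap / self-intersection):
      -- two segments of the same edge meet only if consecutive, and then only at their shared bend
      simpleChain : ∀ e (i j : Fin (length (edgeSegs e))) → toℕ i <ℕ toℕ j →
                    ∀ a b d → CommonAt (proj₁ (lookup (edgeSegs e) i)) (proj₂ (lookup (edgeSegs e) i))
                                       (proj₁ (lookup (edgeSegs e) j)) (proj₂ (lookup (edgeSegs e) j)) a b d →
                    (toℕ j ≡ suc (toℕ i)) × (a ≡ d)
      -- two distinct edges meet only at a common end vertex, or cross (at a point interior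
      -- to both segments) at a right angle; in particular no overlaps
      racCrossings : ∀ e f → e ≢ f → ∀ {p q r s} → (p , q) ∈ edgeSegs e → (r , s) ∈ edgeSegs f →
                     ∀ a b d → CommonAt p q r s a b d →
                     ((dotDir (p , q) (r , s) ≡ + 0) × (+ 0 < a) × (a < d) × (+ 0 < b) × (b < d))
                     ⊎ (∃ λ w → Incident G w e × Incident G w f × OnSegAt p q a d (pos w))

  InBox : ℤ → ℤ → ℤ → ℤ → Point → Set
  InBox x₀ x₁ y₀ y₁ P = (x₀ ≤ X P) × (X P ≤ x₁) × (y₀ ≤ Y P) × (Y P ≤ y₁)

  AreaAtMost : ℕ → Set
  AreaAtMost A = ∃ λ x₀ → ∃ λ x₁ → ∃ λ y₀ → ∃ λ y₁ →
    (∀ v → InBox x₀ x₁ y₀ y₁ (pos v)) ×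
    (∀ e {P} → P ∈ bends e → InBox x₀ x₁ y₀ y₁ P) ×
    (∣ x₁ - x₀ ∣ *ℕ ∣ y₁ - y₀ ∣ ≤ℕ A)

-- Sort the 2m half-edges by decreasing row of their endpoint; the position P of a half-edge in
-- this order is its slot.  A half-edge at (x, y) leaves its vertex along a short fan segment to
-- (2P + 4n + 1 − y, y + 1), to the right of the grid, and the two fan points of an edge are joined
-- through an apex by a segment of slope +1 followed by one of slope −1.  Crossings can then only
-- occur between a slope +1 and a slope −1 segment, hence at right angles.  Every other pair of
-- segments is separated by a level line of a linear functional: x − y or x + y (whose values on
-- the diagonal segments increase with the slot), the row-major sweep −x + K·y, the height y, or
-- the width x.  All coordinates are O(n + m), so the drawing fits in a 4(n + m) × 2(n + m) box.

module Submission where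

open import Defs

module RACDrawing where

  open import Data.Integer using (ℤ; +_; _+_; _-_; _*_; -_; _≤_; _<_; +≤+; +<+; ∣_∣)
  import Data.Integer.Properties as ℤₚ
  open import Data.Integer.Tactic.RingSolver using (solve-∀)
  open import Data.Nat using (ℕ; z≤n; s≤s; suc)
  import Data.Nat as ℕ
  import Data.Nat.Properties as ℕₚ
  import Data.Nat.Tactic.RingSolver as ℕ-Solver
  open import Data.Fin using (Fin; toℕ)
  import Data.Fin as F
  import Data.Fin.Properties as Fₚ
  open import Data.Bool using (Bool; true; false)
  open import Data.List using (List; []; _∷_; _++_; length; allFin; lookup)
  import Data.List.Properties as Lₚ
  open import Data.List.Membership.Propositional using (_∈_)
  open import Data.List.Membership.Propositional.Properties using (∈-allFin)
  open import Data.List.Relation.Unary.Any using (here; there)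
  open import Data.Product using (_×_; _,_; proj₁; proj₂; ∃; Σ)
  open import Data.Sum using (_⊎_; inj₁; inj₂)
  open import Data.Empty using (⊥-elim)
  open import Function using (_∘_)
  open import Relation.Nullary using (¬_; yes; no; Dec)
  open import Relation.Binary.PropositionalEquality
  open import Relation.Binary.Definitions using (tri<; tri≈; tri>)

  -- Linear inequalities are proved by exhibiting the slack as a sum of products of
  -- quantities already known to be nonnegative; the ring solver checks the identity.

  NonNeg : ℤ → Set
  NonNeg z = + 0 ≤ z

  nonNeg : ∀ k → NonNeg (+ k)
  nonNeg k = +≤+ z≤n

  infixl 6 _⊕_
  infixl 7 _⊛_

  _⊕_ : ∀ {i j} → NonNeg i → NonNeg j → NonNeg (i + j)
  _⊕_ {+ a} {+ b} _ _ = nonNeg (a ℕ.+ b)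

  _⊛_ : ∀ {i j} → NonNeg i → NonNeg j → NonNeg (i * j)
  _⊛_ {+ a} {+ b} _ _ = subst NonNeg (ℤₚ.pos-* a b) (nonNeg (a ℕ.* b))

  times : ∀ k {i} → NonNeg i → NonNeg (+ k * i)
  times k = nonNeg k ⊛_

  nonNeg-gap : ∀ {i j} → i < j → NonNeg (j - i - + 1)
  nonNeg-gap {i} {j} i<j = subst NonNeg (shift i j) (ℤₚ.i≤j⇒0≤j-i (ℤₚ.i<j⇒suc[i]≤j i<j))
    where
    shift : ∀ i j → j - (+ 1 + i) ≡ j - i - + 1
    shift = solve-∀

  ≤-by-slack : ∀ {L R} (k : ℤ) → NonNeg k → R ≡ L + k → L ≤ R
  ≤-by-slack {L} {R} k 0≤k R≡L+k =
    subst (L ≤_) (sym R≡L+k) (ℤₚ.0≤i-j⇒j≤i (subst NonNeg (cancel L k) 0≤k))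
    where
    cancel : ∀ L k → k ≡ L + k - L
    cancel = solve-∀

  <-by-slack : ∀ {L R} (k : ℤ) → NonNeg k → R ≡ L + k + + 1 → L < R
  <-by-slack {L} {R} k 0≤k R≡L+k+1 = ℤₚ.suc[i]≤j⇒i<j (≤-by-slack k 0≤k (trans R≡L+k+1 (reorder L k)))
    where
    reorder : ∀ L k → L + k + + 1 ≡ + 1 + L + k
    reorder = solve-∀

  nonNeg+1≢0 : ∀ {k} → NonNeg k → k + + 1 ≢ + 0
  nonNeg+1≢0 {k} 0≤k k+1≡0 = ℤₚ.<⇒≢ (<-by-slack {+ 0} k 0≤k (zero-left k)) (sym k+1≡0)
    where
    zero-left : ∀ k → k + + 1 ≡ + 0 + k + + 1
    zero-left = solve-∀

  -- Segments and level lines of linear functionals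

  lin : ℤ → ℤ → Point → ℤ
  lin α β p = α * X p + β * Y p

  CommonAt-sym : ∀ {p q r s a b d} → CommonAt p q r s a b d → CommonAt r s p q b a d
  CommonAt-sym (0<d , 0≤a , a≤d , 0≤b , b≤d , ex , ey) = 0<d , 0≤b , b≤d , 0≤a , a≤d , sym ex , sym ey

  OnSegAt⇒CommonAt : ∀ {p q a d P} → OnSegAt p q a d P → CommonAt p q P P a (+ 0) d
  OnSegAt⇒CommonAt {p} {q} {a} {d} {P} (0<d , 0≤a , a≤d , ex , ey) =
    0<d , 0≤a , a≤d , ℤₚ.≤-refl , ℤₚ.<⇒≤ 0<d , sym (trans (degenerate d (X P)) ex) , sym (trans (degenerate d (Y P)) ey)
    where
    degenerate : ∀ d z → d * z + + 0 * (z - z) ≡ d * z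
    degenerate = solve-∀

  lin-CommonAt : ∀ α β {p q r s a b d} → CommonAt p q r s a b d →
                 (d - a) * lin α β p + a * lin α β q ≡ (d - b) * lin α β r + b * lin α β s
  lin-CommonAt α β {p} {q} {r} {s} {a} {b} {d} (_ , _ , _ , _ , _ , ex , ey) = begin
    (d - a) * lin α β p + a * lin α β q                           ≡⟨ expand α β d a (X p) (Y p) (X q) (Y q) ⟩
    α * (d * X p + a * (X q - X p)) + β * (d * Y p + a * (Y q - Y p)) ≡⟨ cong₂ (λ u v → α * u + β * v) ex ey ⟩
    α * (d * X r + b * (X s - X r)) + β * (d * Y r + b * (Y s - Y r)) ≡˘⟨ expand α β d b (X r) (Y r) (X s) (Y s) ⟩
    (d - b) * lin α β r + b * lin α β s                           ∎
    where
    open ≡-Reasoning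
    expand : ∀ α β d a px py qx qy → (d - a) * (α * px + β * py) + a * (α * qx + β * qy)
                                     ≡ α * (d * px + a * (qx - px)) + β * (d * py + a * (qy - py))
    expand = solve-∀

  -- If lin ≤ c at p, q and lin > c at r, s then the weighted identity of lin-CommonAt
  -- would equate a quantity ≤ d·c with one ≥ d·c + d.
  separated⇒¬CommonAt : ∀ α β c {p q r s a b d} → lin α β p ≤ c → lin α β q ≤ c → c < lin α β r → c < lin α β s →
                        ¬ CommonAt p q r s a b d
  separated⇒¬CommonAt α β c {p} {q} {r} {s} {a} {b} {d} p≤c q≤c c<r c<s ca@(0<d , 0≤a , a≤d , 0≤b , b≤d , _) =
    nonNeg+1≢0 0≤slack (trans (slack+1 d a b c (lin α β p) (lin α β q) (lin α β r) (lin α β s))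
                              (ℤₚ.i≡j⇒i-j≡0 (sym (lin-CommonAt α β ca))))
    where
    0≤slack : NonNeg ((d - b) * (lin α β r - c - + 1) + b * (lin α β s - c - + 1) + (d - a) * (c - lin α β p)
                      + a * (c - lin α β q) + (d - + 0 - + 1))
    0≤slack = ℤₚ.i≤j⇒0≤j-i b≤d ⊛ nonNeg-gap c<r ⊕ 0≤b ⊛ nonNeg-gap c<s ⊕ ℤₚ.i≤j⇒0≤j-i a≤d ⊛ ℤₚ.i≤j⇒0≤j-i p≤c
              ⊕ 0≤a ⊛ ℤₚ.i≤j⇒0≤j-i q≤c ⊕ nonNeg-gap 0<d
    slack+1 : ∀ d a b c fp fq fr fs →
              (d - b) * (fr - c - + 1) + b * (fs - c - + 1) + (d - a) * (c - fp) + a * (c - fq) + (d - + 0 - + 1) + + 1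
              ≡ (d - b) * fr + b * fs - ((d - a) * fp + a * fq)
    slack+1 = solve-∀

  private
    zero-factor : ∀ {i j} → i * j ≡ + 0 → j ≢ + 0 → i ≡ + 0
    zero-factor {i} ij≡0 j≢0 with ℤₚ.i*j≡0⇒i≡0∨j≡0 i ij≡0
    ... | inj₁ i≡0 = i≡0
    ... | inj₂ j≡0 = ⊥-elim (j≢0 j≡0)

    off-level : ∀ {u c} → u ≢ c → u - c ≢ + 0
    off-level {u} {c} u≢c = u≢c ∘ ℤₚ.i-j≡0⇒i≡j u c

    0<⇒≢0 : ∀ {d} → + 0 < d → d ≢ + 0
    0<⇒≢0 0<d d≡0 = ℤₚ.<⇒≢ 0<d (sym d≡0)

  level-CommonAt : ∀ α β c {p q r s a b d} → lin α β r ≡ c → lin α β s ≡ c → CommonAt p q r s a b d →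
                   (d - a) * (lin α β p - c) + a * (lin α β q - c) ≡ + 0
  level-CommonAt α β c {p} {q} {r} {s} {a} {b} {d} r≡c s≡c ca = begin
    (d - a) * (lin α β p - c) + a * (lin α β q - c)         ≡⟨ collect d a c (lin α β p) (lin α β q) ⟩
    (d - a) * lin α β p + a * lin α β q - d * c             ≡⟨ cong (_- d * c) (lin-CommonAt α β ca) ⟩
    (d - b) * lin α β r + b * lin α β s - d * c             ≡⟨ cong₂ (λ u v → (d - b) * u + b * v - d * c) r≡c s≡c ⟩
    (d - b) * c + b * c - d * c                             ≡⟨ cancel d b c ⟩
    + 0                                                     ∎
    where
    open ≡-Reasoning
    collect : ∀ d a c u v → (d - a) * (u - c) + a * (v - c) ≡ (d - a) * u + a * v - d * c
    collect = solve-∀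
    cancel : ∀ d b c → (d - b) * c + b * c - d * c ≡ + 0
    cancel = solve-∀

  level-CommonAt-end : ∀ α β c {p q r s a b d} → lin α β r ≡ c → lin α β s ≡ c →
                       lin α β p ≢ c → lin α β q ≡ c → CommonAt p q r s a b d → a ≡ d
  level-CommonAt-end α β c {p} {q} {r} {s} {a} {b} {d} r≡c s≡c p≢c q≡c ca =
    sym (ℤₚ.i-j≡0⇒i≡j d a (zero-factor (trans (sym (drop (d - a) (lin α β p - c) a c)) weighted) (off-level p≢c)))
    where
    weighted : (d - a) * (lin α β p - c) + a * (c - c) ≡ + 0
    weighted = subst (λ v → (d - a) * (lin α β p - c) + a * (v - c) ≡ + 0) q≡c (level-CommonAt α β c r≡c s≡c ca)
    drop : ∀ k x a c → k * x + a * (c - c) ≡ k * x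
    drop = solve-∀

  level-CommonAt-start : ∀ α β c {p q r s a b d} → lin α β r ≡ c → lin α β s ≡ c →
                         lin α β p ≡ c → lin α β q ≢ c → CommonAt p q r s a b d → a ≡ + 0
  level-CommonAt-start α β c {p} {q} {r} {s} {a} {b} {d} r≡c s≡c p≡c q≢c ca =
    zero-factor (trans (sym (drop (d - a) c a (lin α β q - c))) weighted) (off-level q≢c)
    where
    weighted : (d - a) * (c - c) + a * (lin α β q - c) ≡ + 0
    weighted = subst (λ u → (d - a) * (u - c) + a * (lin α β q - c) ≡ + 0) p≡c (level-CommonAt α β c r≡c s≡c ca)
    drop : ∀ k c a y → k * (c - c) + a * y ≡ a * y
    drop = solve-∀

  level-CommonAt-interior : ∀ α β c {p q r s a b d} → lin α β r ≡ c → lin α β s ≡ c →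
                            lin α β p ≢ c → lin α β q ≢ c → CommonAt p q r s a b d → (+ 0 < a) × (a < d)
  level-CommonAt-interior α β c {p} {q} {r} {s} {a} {b} {d} r≡c s≡c p≢c q≢c ca@(0<d , 0≤a , a≤d , _) =
    ℤₚ.≤∧≢⇒< 0≤a (a≢0 ∘ sym) , ℤₚ.≤∧≢⇒< a≤d a≢d
    where
    weighted = level-CommonAt α β c r≡c s≡c ca
    a≢0 : a ≢ + 0
    a≢0 refl = off-level p≢c (zero-factor (trans (sym (at-start d (lin α β p - c) (lin α β q - c))) weighted) (0<⇒≢0 0<d))
      where
      at-start : ∀ d x y → (d - + 0) * x + + 0 * y ≡ x * d
      at-start = solve-∀
    a≢d : a ≢ d
    a≢d refl = off-level q≢c (zero-factor (trans (sym (at-end a (lin α β p - c) (lin α β q - c))) weighted) (0<⇒≢0 0<d))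
      where
      at-end : ∀ d x y → (d - d) * x + d * y ≡ y * d
      at-end = solve-∀

  Traverses : Point → Point → Point → Point → Set
  Traverses p₀ q₀ p q = (p ≡ p₀ × q ≡ q₀) ⊎ (p ≡ q₀ × q ≡ p₀)

  Traverses-ends : (P : Point → Set) → ∀ {p₀ q₀ p q} → P p₀ → P q₀ → Traverses p₀ q₀ p q → P p × P q
  Traverses-ends P Pp₀ Pq₀ (inj₁ (refl , refl)) = Pp₀ , Pq₀
  Traverses-ends P Pp₀ Pq₀ (inj₂ (refl , refl)) = Pq₀ , Pp₀

  Traverses-nondegenerate : ∀ {p₀ q₀ p q} → p₀ ≢ q₀ → Traverses p₀ q₀ p q → p ≢ q
  Traverses-nondegenerate p₀≢q₀ (inj₁ (refl , refl)) = p₀≢q₀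
  Traverses-nondegenerate p₀≢q₀ (inj₂ (refl , refl)) = λ q₀≡p₀ → p₀≢q₀ (sym q₀≡p₀)

  separated⇒¬CommonAt′ : ∀ α β c {p₀ q₀ r₀ s₀ p q r s a b d} →
                         lin α β p₀ ≤ c → lin α β q₀ ≤ c → c < lin α β r₀ → c < lin α β s₀ →
                         Traverses p₀ q₀ p q → Traverses r₀ s₀ r s → ¬ CommonAt p q r s a b d
  separated⇒¬CommonAt′ α β c p₀≤c q₀≤c c<r₀ c<s₀ pq rs
    with Traverses-ends (λ x → lin α β x ≤ c) p₀≤c q₀≤c pq | Traverses-ends (λ x → c < lin α β x) c<r₀ c<s₀ rs
  ... | p≤c , q≤c | c<r , c<s = separated⇒¬CommonAt α β c p≤c q≤c c<r c<s

  below⇒¬OnSegAt : ∀ α β c {p₀ q₀ p q a d P} → lin α β p₀ ≤ c → lin α β q₀ ≤ c → c < lin α β P →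
                   Traverses p₀ q₀ p q → ¬ OnSegAt p q a d P
  below⇒¬OnSegAt α β c {p = p} {q} {a} {d} {P} p₀≤c q₀≤c c<P pq onSeg =
    separated⇒¬CommonAt′ α β c {r₀ = P} {s₀ = P} p₀≤c q₀≤c c<P c<P pq (inj₁ (refl , refl))
      (OnSegAt⇒CommonAt {p} {q} {a} {d} {P} onSeg)

  above⇒¬OnSegAt : ∀ α β c {p₀ q₀ p q a d P} → c < lin α β p₀ → c < lin α β q₀ → lin α β P ≤ c →
                   Traverses p₀ q₀ p q → ¬ OnSegAt p q a d P
  above⇒¬OnSegAt α β c {p = p} {q} {a} {d} {P} c<p₀ c<q₀ P≤c pq onSeg =
    separated⇒¬CommonAt′ α β c {p₀ = P} {q₀ = P} P≤c P≤c c<p₀ c<q₀ (inj₁ (refl , refl)) pq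
      (CommonAt-sym {p} {q} {P} {P} (OnSegAt⇒CommonAt {p} {q} {a} {d} {P} onSeg))

  level-CommonAt-interior′ : ∀ α β c {p₀ q₀ r₀ s₀ p q r s a b d} → lin α β r₀ ≡ c → lin α β s₀ ≡ c →
                             lin α β p₀ ≢ c → lin α β q₀ ≢ c → Traverses p₀ q₀ p q → Traverses r₀ s₀ r s →
                             CommonAt p q r s a b d → (+ 0 < a) × (a < d)
  level-CommonAt-interior′ α β c r₀≡c s₀≡c p₀≢c q₀≢c pq rs
    with Traverses-ends (λ x → lin α β x ≢ c) p₀≢c q₀≢c pq | Traverses-ends (λ x → lin α β x ≡ c) r₀≡c s₀≡c rs
  ... | p≢c , q≢c | r≡c , s≡c = level-CommonAt-interior α β c r≡c s≡c p≢c q≢c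

  level-shared-endpoint : ∀ α β c {w u v p q r s a b d} → lin α β w ≡ c → lin α β u ≡ c → lin α β v ≢ c →
                          Traverses w u p q → Traverses w v r s → CommonAt p q r s a b d → OnSegAt p q a d w
  level-shared-endpoint α β c {w} {u} {v} {p} {q} {r} {s} {a} {b} {d} w≡c u≡c v≢c pq rs
                        ca@(0<d , 0≤a , a≤d , 0≤b , b≤d , ex , ey)
    with Traverses-ends (λ x → lin α β x ≡ c) w≡c u≡c pq | rs
  ... | p≡c , q≡c | inj₁ (refl , refl) =
    0<d , 0≤a , a≤d , point-at (X p) (X q) (X r) (X s) ex , point-at (Y p) (Y q) (Y r) (Y s) ey
    where
    b≡0 : b ≡ + 0
    b≡0 = level-CommonAt-start α β c p≡c q≡c w≡c v≢c (CommonAt-sym {p} {q} {r} {s} ca)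
    point-at : ∀ zp zq zr zs → d * zp + a * (zq - zp) ≡ d * zr + b * (zs - zr) → d * zr ≡ d * zp + a * (zq - zp)
    point-at zp zq zr zs e = sym (trans e (trans (cong (λ b → d * zr + b * (zs - zr)) b≡0) (from-start d zr zs)))
      where
      from-start : ∀ d x y → d * x + + 0 * (y - x) ≡ d * x
      from-start = solve-∀
  ... | p≡c , q≡c | inj₂ (refl , refl) =
    0<d , 0≤a , a≤d , point-at (X p) (X q) (X r) (X s) ex , point-at (Y p) (Y q) (Y r) (Y s) ey
    where
    b≡d : b ≡ d
    b≡d = level-CommonAt-end α β c p≡c q≡c v≢c w≡c (CommonAt-sym {p} {q} {r} {s} ca)
    point-at : ∀ zp zq zr zs → d * zp + a * (zq - zp) ≡ d * zr + b * (zs - zr) → d * zs ≡ d * zp + a * (zq - zp)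
    point-at zp zq zr zs e = sym (trans e (trans (cong (λ b → d * zr + b * (zs - zr)) b≡d) (from-end d zr zs)))
      where
      from-end : ∀ d x y → d * x + d * (y - x) ≡ d * y
      from-end = solve-∀

  Ascending Descending : Point → Point → Set
  Ascending p q = X q - X p ≡ Y q - Y p
  Descending p q = X q - X p ≡ - (Y q - Y p)

  private
    reverse-diff : ∀ a b → a - b ≡ - (b - a)
    reverse-diff = solve-∀

  Traverses-ascending : ∀ {p₀ q₀ p q} → Ascending p₀ q₀ → Traverses p₀ q₀ p q → Ascending p q
  Traverses-ascending asc (inj₁ (refl , refl)) = asc
  Traverses-ascending {p₀} {q₀} asc (inj₂ (refl , refl)) =
    trans (reverse-diff (X p₀) (X q₀)) (trans (cong -_ asc) (sym (reverse-diff (Y p₀) (Y q₀))))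

  Traverses-descending : ∀ {p₀ q₀ p q} → Descending p₀ q₀ → Traverses p₀ q₀ p q → Descending p q
  Traverses-descending desc (inj₁ (refl , refl)) = desc
  Traverses-descending {p₀} {q₀} desc (inj₂ (refl , refl)) =
    trans (reverse-diff (X p₀) (X q₀)) (cong -_ (trans desc (sym (reverse-diff (Y p₀) (Y q₀)))))

  ascending-descending-perpendicular : ∀ {p q r s} → Ascending p q → Descending r s → dotDir (p , q) (r , s) ≡ + 0
  ascending-descending-perpendicular {p} {q} {r} {s} asc desc =
    trans (cong₂ (λ u v → u * v + (Y q - Y p) * (Y s - Y r)) asc desc) (cancel (Y q - Y p) (Y s - Y r))
    where
    cancel : ∀ u v → u * (- v) + u * v ≡ + 0
    cancel = solve-∀

  dotDir-comm : ∀ s t → dotDir s t ≡ dotDir t s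
  dotDir-comm ((px , py) , (qx , qy)) ((rx , ry) , (sx , sy)) = swap-factors px py qx qy rx ry sx sy
    where
    swap-factors : ∀ px py qx qy rx ry sx sy →
                   (qx - px) * (sx - rx) + (qy - py) * (sy - ry) ≡ (sx - rx) * (qx - px) + (sy - ry) * (qy - py)
    swap-factors = solve-∀

  SimpleChain : List (Point × Point) → Set
  SimpleChain σs = ∀ (i j : Fin (length σs)) → toℕ i ℕ.< toℕ j → ∀ a b d →
                   CommonAt (proj₁ (lookup σs i)) (proj₂ (lookup σs i)) (proj₁ (lookup σs j)) (proj₂ (lookup σs j)) a b d →
                   (toℕ j ≡ suc (toℕ i)) × (a ≡ d)

  MeetOnlyAtJoint : Point → Point → Point → Set
  MeetOnlyAtJoint p q s = ∀ {a b d} → CommonAt p q q s a b d → a ≡ d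

  Apart : Point → Point → Point → Point → Set
  Apart p q r s = ∀ {a b d} → ¬ CommonAt p q r s a b d

  level-joint : ∀ α β c p q s → lin α β p ≢ c → lin α β q ≡ c → lin α β s ≡ c → MeetOnlyAtJoint p q s
  level-joint α β c p q s p≢c q≡c s≡c = level-CommonAt-end α β c {p} {q} {q} {s} q≡c s≡c p≢c q≡c

  simpleChain₄ : ∀ p₀ p₁ p₂ p₃ p₄ → MeetOnlyAtJoint p₀ p₁ p₂ → MeetOnlyAtJoint p₁ p₂ p₃ → MeetOnlyAtJoint p₂ p₃ p₄ →
                 Apart p₀ p₁ p₂ p₃ → Apart p₀ p₁ p₃ p₄ → Apart p₁ p₂ p₃ p₄ →
                 SimpleChain ((p₀ , p₁) ∷ (p₁ , p₂) ∷ (p₂ , p₃) ∷ (p₃ , p₄) ∷ [])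
  simpleChain₄ _ _ _ _ _ j₀₁ j₁₂ j₂₃ a₀₂ a₀₃ a₁₃ = pairs
    where
    pairs : SimpleChain _
    pairs F.zero (F.suc F.zero) _ a b d ca = refl , j₀₁ ca
    pairs (F.suc F.zero) (F.suc (F.suc F.zero)) _ a b d ca = refl , j₁₂ ca
    pairs (F.suc (F.suc F.zero)) (F.suc (F.suc (F.suc F.zero))) _ a b d ca = refl , j₂₃ ca
    pairs F.zero (F.suc (F.suc F.zero)) _ a b d ca = ⊥-elim (a₀₂ ca)
    pairs F.zero (F.suc (F.suc (F.suc F.zero))) _ a b d ca = ⊥-elim (a₀₃ ca)
    pairs (F.suc F.zero) (F.suc (F.suc (F.suc F.zero))) _ a b d ca = ⊥-elim (a₁₃ ca)
    pairs F.zero F.zero () a b d ca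
    pairs (F.suc i) F.zero () a b d ca
    pairs (F.suc F.zero) (F.suc F.zero) (s≤s ()) a b d ca
    pairs (F.suc (F.suc i)) (F.suc F.zero) (s≤s ()) a b d ca
    pairs (F.suc (F.suc F.zero)) (F.suc (F.suc F.zero)) (s≤s (s≤s ())) a b d ca
    pairs (F.suc (F.suc (F.suc i))) (F.suc (F.suc F.zero)) (s≤s (s≤s ())) a b d ca
    pairs (F.suc (F.suc (F.suc F.zero))) (F.suc (F.suc (F.suc F.zero))) (s≤s (s≤s (s≤s ()))) a b d ca

  -- Ranking by a key

  module _ {A : Set} (key : A → ℕ) where

    countBelow : List A → ℕ → ℕ
    countBelow [] k = 0
    countBelow (y ∷ ys) k with key y ℕ.<? k
    ... | yes _ = suc (countBelow ys k)
    ... | no _ = countBelow ys k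

    countBelow-≤-length : ∀ ys {k} → countBelow ys k ℕ.≤ length ys
    countBelow-≤-length [] = z≤n
    countBelow-≤-length (y ∷ ys) {k} with key y ℕ.<? k
    ... | yes _ = s≤s (countBelow-≤-length ys)
    ... | no _ = ℕₚ.m≤n⇒m≤1+n (countBelow-≤-length ys)

    countBelow-mono : ∀ ys {k k′} → k ℕ.≤ k′ → countBelow ys k ℕ.≤ countBelow ys k′
    countBelow-mono [] k≤k′ = z≤n
    countBelow-mono (y ∷ ys) {k} {k′} k≤k′ with key y ℕ.<? k | key y ℕ.<? k′
    ... | yes _ | yes _ = s≤s (countBelow-mono ys k≤k′)
    ... | yes y<k | no y≮k′ = ⊥-elim (y≮k′ (ℕₚ.<-≤-trans y<k k≤k′))
    ... | no _ | yes _ = ℕₚ.m≤n⇒m≤1+n (countBelow-mono ys k≤k′)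
    ... | no _ | no _ = countBelow-mono ys k≤k′

    countBelow-strict : ∀ ys {x k k′} → x ∈ ys → k ℕ.≤ key x → key x ℕ.< k′ → countBelow ys k ℕ.< countBelow ys k′
    countBelow-strict (y ∷ ys) {x} {k} {k′} (here refl) k≤x x<k′ with key y ℕ.<? k | key y ℕ.<? k′
    ... | yes x<k | _ = ⊥-elim (ℕₚ.<⇒≱ x<k k≤x)
    ... | no _ | yes _ = s≤s (countBelow-mono ys (ℕₚ.≤-trans k≤x (ℕₚ.<⇒≤ x<k′)))
    ... | no _ | no x≮k′ = ⊥-elim (x≮k′ x<k′)
    countBelow-strict (y ∷ ys) {x} {k} {k′} (there x∈ys) k≤x x<k′ with key y ℕ.<? k | key y ℕ.<? k′
    ... | yes _ | yes _ = s≤s (countBelow-strict ys x∈ys k≤x x<k′)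
    ... | yes y<k | no y≮k′ = ⊥-elim (y≮k′ (ℕₚ.<-trans (ℕₚ.<-≤-trans y<k k≤x) x<k′))
    ... | no _ | yes _ = ℕₚ.m≤n⇒m≤1+n (countBelow-strict ys x∈ys k≤x x<k′)
    ... | no _ | no _ = countBelow-strict ys x∈ys k≤x x<k′

    countBelow-key<length : ∀ ys {x} → x ∈ ys → countBelow ys (key x) ℕ.< length ys
    countBelow-key<length (y ∷ ys) (here refl) with key y ℕ.<? key y
    ... | yes y<y = ⊥-elim (ℕₚ.<-irrefl refl y<y)
    ... | no _ = s≤s (countBelow-≤-length ys)
    countBelow-key<length (y ∷ ys) {x} (there x∈ys) with key y ℕ.<? key x
    ... | yes _ = s≤s (countBelow-key<length ys x∈ys)
    ... | no _ = ℕₚ.m≤n⇒m≤1+n (countBelow-key<length ys x∈ys)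

  module Ranking {A : Set} (key : A → ℕ) (elems : List A) (∈-elems : ∀ x → x ∈ elems)
                 (key-injective : ∀ x y → key x ≡ key y → x ≡ y) where

    opaque
      rank : A → ℕ
      rank x = countBelow key elems (key x)

      rank-< : ∀ x y → key x ℕ.< key y → rank x ℕ.< rank y
      rank-< x y = countBelow-strict key elems (∈-elems x) ℕₚ.≤-refl

      rank<length : ∀ x → rank x ℕ.< length elems
      rank<length x = countBelow-key<length key elems (∈-elems x)

    rank-injective : ∀ x y → rank x ≡ rank y → x ≡ y
    rank-injective x y rx≡ry with ℕₚ.<-cmp (key x) (key y)
    ... | tri< kx<ky _ _ = ⊥-elim (ℕₚ.<-irrefl rx≡ry (rank-< x y kx<ky))
    ... | tri≈ _ kx≡ky _ = key-injective x y kx≡ky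
    ... | tri> _ _ ky<kx = ⊥-elim (ℕₚ.<-irrefl (sym rx≡ry) (rank-< y x ky<kx))

  module Construction {n m : ℕ} (G : Graph n m) (S : Fin n → Point) (grid : IsGridPointSet n S)
                      (μ : Fin n → Fin n) (μ-injective : ∀ {u v} → μ u ≡ μ v → u ≡ v) where

    point : Fin n → Point
    point v = S (μ v)

    vx vy : Fin n → ℤ
    vx v = X (point v)
    vy v = Y (point v)

    1≤vx : ∀ v → + 1 ≤ vx v
    1≤vx v = proj₁ (proj₁ grid (μ v))

    vx≤n : ∀ v → vx v ≤ + n
    vx≤n v = proj₁ (proj₂ (proj₁ grid (μ v)))

    1≤vy : ∀ v → + 1 ≤ vy v
    1≤vy v = proj₁ (proj₂ (proj₂ (proj₁ grid (μ v))))

    vy≤n : ∀ v → vy v ≤ + n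
    vy≤n v = proj₂ (proj₂ (proj₂ (proj₁ grid (μ v))))

    vy-injective : ∀ v w → vy v ≡ vy w → v ≡ w
    vy-injective v w vy≡ with μ v F.≟ μ w
    ... | yes μv≡μw = μ-injective μv≡μw
    ... | no μv≢μw = ⊥-elim (proj₂ (proj₂ grid (μ v) (μ w) μv≢μw) vy≡)

    row : Fin n → ℕ
    row v = ∣ vy v ∣

    vy≡row : ∀ v → vy v ≡ + row v
    vy≡row v = sym (ℤₚ.0≤i⇒+∣i∣≡i (ℤₚ.≤-trans (+≤+ ℕ.z≤n) (1≤vy v)))

    row≤n : ∀ v → row v ℕ.≤ n
    row≤n v = ℤₚ.drop‿+≤+ (subst (_≤ + n) (vy≡row v) (vy≤n v))

    vy<⇒row< : ∀ {v w} → vy v < vy w → row v ℕ.< row w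
    vy<⇒row< {v} {w} lt = ℤₚ.drop‿+<+ (subst₂ _<_ (vy≡row v) (vy≡row w) lt)

    end₁ end₂ : Fin m → Fin n
    end₁ e = proj₁ (ends G e)
    end₂ e = proj₂ (ends G e)

    Orientation : Fin m → Set
    Orientation e = Dec (vy (end₂ e) < vy (end₁ e))

    orient : ∀ e → Orientation e
    orient e = vy (end₂ e) ℤₚ.<? vy (end₁ e)

    upperOf lowerOf : ∀ e → Orientation e → Fin n
    upperOf e (yes _) = end₁ e
    upperOf e (no _) = end₂ e
    lowerOf e (yes _) = end₂ e
    lowerOf e (no _) = end₁ e

    upper lower : Fin m → Fin n
    upper e = upperOf e (orient e)
    lower e = lowerOf e (orient e)

    lowerOf<upperOf : ∀ e o → vy (lowerOf e o) < vy (upperOf e o)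
    lowerOf<upperOf e (yes lt) = lt
    lowerOf<upperOf e (no ≮) = ℤₚ.≤∧≢⇒< (ℤₚ.≮⇒≥ ≮) (λ eq → loopless G e (vy-injective _ _ eq))

    lower<upper : ∀ e → vy (lower e) < vy (upper e)
    lower<upper e = lowerOf<upperOf e (orient e)

    upperOf-incident : ∀ e o → Incident G (upperOf e o) e
    upperOf-incident e (yes _) = inj₁ refl
    upperOf-incident e (no _) = inj₂ refl

    lowerOf-incident : ∀ e o → Incident G (lowerOf e o) e
    lowerOf-incident e (yes _) = inj₂ refl
    lowerOf-incident e (no _) = inj₁ refl

    HalfEdge : Set
    HalfEdge = Fin m × Bool

    upperHalf lowerHalf : Fin m → HalfEdge
    upperHalf e = (e , true)
    lowerHalf e = (e , false)

    upper≢lower : ∀ {e f} → upperHalf e ≢ lowerHalf f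
    upper≢lower ()

    endpoint : HalfEdge → Fin n
    endpoint (e , true) = upper e
    endpoint (e , false) = lower e

    endpoint-incident : ∀ h → Incident G (endpoint h) (proj₁ h)
    endpoint-incident (e , true) = upperOf-incident e (orient e)
    endpoint-incident (e , false) = lowerOf-incident e (orient e)

    halvesOf : List (Fin m) → List HalfEdge
    halvesOf [] = []
    halvesOf (e ∷ es) = upperHalf e ∷ lowerHalf e ∷ halvesOf es

    ∈-halvesOf : ∀ es e b → e ∈ es → (e , b) ∈ halvesOf es
    ∈-halvesOf (e ∷ es) e true (here refl) = here refl
    ∈-halvesOf (e ∷ es) e false (here refl) = there (here refl)
    ∈-halvesOf (_ ∷ es) e b (there e∈es) = there (there (∈-halvesOf es e b e∈es))

    length-halvesOf : ∀ es → length (halvesOf es) ≡ length es ℕ.+ length es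
    length-halvesOf [] = refl
    length-halvesOf (_ ∷ es) = cong suc (trans (cong suc (length-halvesOf es)) (sym (ℕₚ.+-suc (length es) (length es))))

    allHalves : List HalfEdge
    allHalves = halvesOf (allFin m)

    ∈-allHalves : ∀ h → h ∈ allHalves
    ∈-allHalves (e , b) = ∈-halvesOf (allFin m) e b (∈-allFin e)

    length-allHalves : length allHalves ≡ m ℕ.+ m
    length-allHalves = trans (length-halvesOf (allFin m)) (cong₂ ℕ._+_ length-allFin length-allFin)
      where
      length-allFin : length (allFin m) ≡ m
      length-allFin = Lₚ.length-tabulate {n = m} (λ i → i)

    index : HalfEdge → ℕ
    index (e , true) = toℕ e
    index (e , false) = toℕ e ℕ.+ m

    index<2m : ∀ h → index h ℕ.< m ℕ.+ m
    index<2m (e , true) = ℕₚ.<-≤-trans (Fₚ.toℕ<n e) (ℕₚ.m≤m+n m m)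
    index<2m (e , false) = ℕₚ.+-monoˡ-< m (Fₚ.toℕ<n e)

    index-injective : ∀ h h′ → index h ≡ index h′ → h ≡ h′
    index-injective (e , true) (e′ , true) eq = cong (_, true) (Fₚ.toℕ-injective eq)
    index-injective (e , false) (e′ , false) eq = cong (_, false) (Fₚ.toℕ-injective (ℕₚ.+-cancelʳ-≡ m (toℕ e) (toℕ e′) eq))
    index-injective (e , true) (e′ , false) eq = ⊥-elim (ℕₚ.<⇒≱ (Fₚ.toℕ<n e) (subst (m ℕ.≤_) (sym eq) (ℕₚ.m≤n+m m (toℕ e′))))
    index-injective (e , false) (e′ , true) eq = ⊥-elim (ℕₚ.<⇒≱ (Fₚ.toℕ<n e′) (subst (m ℕ.≤_) eq (ℕₚ.m≤n+m m (toℕ e))))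

    halfRow : HalfEdge → ℕ
    halfRow h = row (endpoint h)

    sortKey : HalfEdge → ℕ
    sortKey h = (n ℕ.∸ halfRow h) ℕ.* (m ℕ.+ m) ℕ.+ index h

    sortKey-< : ∀ h h′ → halfRow h′ ℕ.< halfRow h → sortKey h ℕ.< sortKey h′
    sortKey-< h h′ lt = begin-strict
      (n ℕ.∸ halfRow h) ℕ.* (m ℕ.+ m) ℕ.+ index h    <⟨ ℕₚ.+-monoʳ-< ((n ℕ.∸ halfRow h) ℕ.* (m ℕ.+ m)) (index<2m h) ⟩
      (n ℕ.∸ halfRow h) ℕ.* (m ℕ.+ m) ℕ.+ (m ℕ.+ m)  ≡⟨ ℕₚ.+-comm ((n ℕ.∸ halfRow h) ℕ.* (m ℕ.+ m)) (m ℕ.+ m) ⟩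
      suc (n ℕ.∸ halfRow h) ℕ.* (m ℕ.+ m)             ≤⟨ ℕₚ.*-monoˡ-≤ (m ℕ.+ m) (ℕₚ.∸-monoʳ-< lt (row≤n (endpoint h))) ⟩
      (n ℕ.∸ halfRow h′) ℕ.* (m ℕ.+ m)               ≤⟨ ℕₚ.m≤m+n _ (index h′) ⟩
      sortKey h′                                     ∎
      where open ℕₚ.≤-Reasoning

    sortKey-injective : ∀ h h′ → sortKey h ≡ sortKey h′ → h ≡ h′
    sortKey-injective h h′ eq with ℕₚ.<-cmp (halfRow h) (halfRow h′)
    ... | tri< lt _ _ = ⊥-elim (ℕₚ.<-irrefl (sym eq) (sortKey-< h′ h lt))
    ... | tri> _ _ gt = ⊥-elim (ℕₚ.<-irrefl eq (sortKey-< h h′ gt))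
    ... | tri≈ _ rows≡ _ = index-injective h h′ (ℕₚ.+-cancelˡ-≡ ((n ℕ.∸ halfRow h) ℕ.* (m ℕ.+ m)) (index h) (index h′)
                             (trans eq (cong (λ r → (n ℕ.∸ r) ℕ.* (m ℕ.+ m) ℕ.+ index h′) (sym rows≡))))

    open Ranking sortKey allHalves ∈-allHalves sortKey-injective

    rank-<⇒row-≥ : ∀ h h′ → rank h ℕ.< rank h′ → halfRow h′ ℕ.≤ halfRow h
    rank-<⇒row-≥ h h′ lt with ℕₚ.<-cmp (halfRow h) (halfRow h′)
    ... | tri< r<r′ _ _ = ⊥-elim (ℕₚ.<-asym lt (rank-< h′ h (sortKey-< h′ h r<r′)))
    ... | tri≈ _ r≡r′ _ = ℕₚ.≤-reflexive (sym r≡r′)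
    ... | tri> _ _ r′<r = ℕₚ.<⇒≤ r′<r

    slot : HalfEdge → ℤ
    slot h = + rank h

    hx hy : HalfEdge → ℤ
    hx h = vx (endpoint h)
    hy h = vy (endpoint h)

    0≤slot : ∀ h → NonNeg (slot h)
    0≤slot h = nonNeg (rank h)

    slot<2m : ∀ h → NonNeg (+ m + + m - slot h - + 1)
    slot<2m h = subst NonNeg (cong (λ z → z - slot h - + 1) (ℤₚ.pos-+ m m))
                  (nonNeg-gap (+<+ (subst (rank h ℕ.<_) length-allHalves (rank<length h))))

    higher⇒smaller-slot : ∀ h h′ → hy h′ < hy h → slot h < slot h′
    higher⇒smaller-slot h h′ lt = +<+ (rank-< h h′ (sortKey-< h h′ (vy<⇒row< lt)))

    slot-injective : ∀ h h′ → slot h ≡ slot h′ → h ≡ h′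
    slot-injective h h′ eq = rank-injective h h′ (ℤₚ.+-injective eq)

    smaller-slot⇒not-lower : ∀ h h′ → slot h < slot h′ → hy h′ ≤ hy h
    smaller-slot⇒not-lower h h′ (+<+ lt) =
      subst₂ _≤_ (sym (vy≡row (endpoint h′))) (sym (vy≡row (endpoint h))) (+≤+ (rank-<⇒row-≥ h h′ lt))

    upperSlot<lowerSlot : ∀ e → slot (upperHalf e) < slot (lowerHalf e)
    upperSlot<lowerSlot e = higher⇒smaller-slot (upperHalf e) (lowerHalf e) (lower<upper e)

    0≤vx-1 : ∀ v → NonNeg (vx v - + 1)
    0≤vx-1 v = ℤₚ.i≤j⇒0≤j-i (1≤vx v)

    0≤n-vx : ∀ v → NonNeg (+ n - vx v)
    0≤n-vx v = ℤₚ.i≤j⇒0≤j-i (vx≤n v)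

    0≤vy-1 : ∀ v → NonNeg (vy v - + 1)
    0≤vy-1 v = ℤₚ.i≤j⇒0≤j-i (1≤vy v)

    0≤n-vy : ∀ v → NonNeg (+ n - vy v)
    0≤n-vy v = ℤₚ.i≤j⇒0≤j-i (vy≤n v)

    0≤rowGap : ∀ e → NonNeg (vy (upper e) - vy (lower e) - + 1)
    0≤rowGap e = nonNeg-gap (lower<upper e)

    0≤slotGap : ∀ e → NonNeg (slot (lowerHalf e) - slot (upperHalf e) - + 1)
    0≤slotGap e = nonNeg-gap (upperSlot<lowerSlot e)

    fanX : HalfEdge → ℤ
    fanX h = + 2 * slot h + + 4 * + n + + 1 - hy h

    fan : HalfEdge → Point
    fan h = fanX h , hy h + + 1

    -- The meeting point of the slope +1 line through the upper fan point of e and the slope −1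
    -- line through its lower fan point.
    apex : Fin m → Point
    apex e = slot (upperHalf e) + slot (lowerHalf e) + + 4 * + n + + 1 - vy (upper e) ,
             vy (upper e) + + 1 + slot (lowerHalf e) - slot (upperHalf e)

    xMinusY xPlusY height width : Point → ℤ
    xMinusY = lin (+ 1) (- + 1)
    xPlusY = lin (+ 1) (+ 1)
    height = lin (+ 0) (+ 1)
    width = lin (+ 1) (+ 0)

    ascLevel descLevel : HalfEdge → ℤ
    ascLevel h = + 2 * slot h + + 4 * + n - + 2 * hy h
    descLevel h = + 2 * slot h + + 4 * + n + + 2

    fan-on-ascLevel : ∀ h → xMinusY (fan h) ≡ ascLevel h
    fan-on-ascLevel h = identity (+ n) (slot h) (hy h)
      where
      identity : ∀ n P y → + 1 * (+ 2 * P + + 4 * n + + 1 - y) + (- + 1) * (y + + 1) ≡ + 2 * P + + 4 * n - + 2 * y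
      identity = solve-∀

    apex-on-ascLevel : ∀ e → xMinusY (apex e) ≡ ascLevel (upperHalf e)
    apex-on-ascLevel e = identity (+ n) (slot (upperHalf e)) (slot (lowerHalf e)) (vy (upper e))
      where
      identity : ∀ n Pa Pb y → + 1 * (Pa + Pb + + 4 * n + + 1 - y) + (- + 1) * (y + + 1 + Pb - Pa) ≡ + 2 * Pa + + 4 * n - + 2 * y
      identity = solve-∀

    fan-on-descLevel : ∀ h → xPlusY (fan h) ≡ descLevel h
    fan-on-descLevel h = identity (+ n) (slot h) (hy h)
      where
      identity : ∀ n P y → + 1 * (+ 2 * P + + 4 * n + + 1 - y) + + 1 * (y + + 1) ≡ + 2 * P + + 4 * n + + 2
      identity = solve-∀

    apex-on-descLevel : ∀ e → xPlusY (apex e) ≡ descLevel (lowerHalf e)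
    apex-on-descLevel e = identity (+ n) (slot (upperHalf e)) (slot (lowerHalf e)) (vy (upper e))
      where
      identity : ∀ n Pa Pb y → + 1 * (Pa + Pb + + 4 * n + + 1 - y) + + 1 * (y + + 1 + Pb - Pa) ≡ + 2 * Pb + + 4 * n + + 2
      identity = solve-∀

    ascent-ascending : ∀ e → Ascending (fan (upperHalf e)) (apex e)
    ascent-ascending e = identity (+ n) (slot (upperHalf e)) (slot (lowerHalf e)) (vy (upper e))
      where
      identity : ∀ n Pa Pb y → (Pa + Pb + + 4 * n + + 1 - y) - (+ 2 * Pa + + 4 * n + + 1 - y) ≡ (y + + 1 + Pb - Pa) - (y + + 1)
      identity = solve-∀

    descent-descending : ∀ e → Descending (apex e) (fan (lowerHalf e))
    descent-descending e = identity (+ n) (slot (upperHalf e)) (slot (lowerHalf e)) (vy (upper e)) (vy (lower e))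
      where
      identity : ∀ n Pa Pb yu yl → (+ 2 * Pb + + 4 * n + + 1 - yl) - (Pa + Pb + + 4 * n + + 1 - yu)
                                   ≡ - ((yl + + 1) - (yu + + 1 + Pb - Pa))
      identity = solve-∀

    vertex-below-ascLevel : ∀ h → xMinusY (point (endpoint h)) < ascLevel h
    vertex-below-ascLevel h =
      <-by-slack _ (times 2 (0≤slot h) ⊕ 0≤n-vy v ⊕ 0≤n-vx v ⊕ times 2 (0≤vx-1 v) ⊕ times 2 (0≤n-vx v) ⊕ nonNeg 1)
        (split (+ n) (slot h) (hx h) (hy h))
      where
      v = endpoint h
      split : ∀ n P x y → + 2 * P + + 4 * n - + 2 * y
                          ≡ (+ 1 * x + (- + 1) * y) + (+ 2 * P + (n - y) + (n - x) + + 2 * (x - + 1) + + 2 * (n - x) + + 1) + + 1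
      split = solve-∀

    vertex-below-descLevel : ∀ h → xPlusY (point (endpoint h)) < descLevel h
    vertex-below-descLevel h =
      <-by-slack _ (times 2 (0≤slot h) ⊕ 0≤n-vx v ⊕ 0≤n-vy v ⊕ times 2 (0≤vx-1 v) ⊕ times 2 (0≤n-vx v) ⊕ nonNeg 3)
        (split (+ n) (slot h) (hx h) (hy h))
      where
      v = endpoint h
      split : ∀ n P x y → + 2 * P + + 4 * n + + 2
                          ≡ (+ 1 * x + + 1 * y) + (+ 2 * P + (n - x) + (n - y) + + 2 * (x - + 1) + + 2 * (n - x) + + 3) + + 1
      split = solve-∀

    ascLevel-< : ∀ h h′ → slot h < slot h′ → ascLevel h < ascLevel h′
    ascLevel-< h h′ lt =
      <-by-slack _ (times 2 (nonNeg-gap lt) ⊕ times 2 (ℤₚ.i≤j⇒0≤j-i (smaller-slot⇒not-lower h h′ lt)) ⊕ nonNeg 1)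
        (split (+ n) (slot h) (slot h′) (hy h) (hy h′))
      where
      split : ∀ n P P′ y y′ → + 2 * P′ + + 4 * n - + 2 * y′
                              ≡ (+ 2 * P + + 4 * n - + 2 * y) + (+ 2 * (P′ - P - + 1) + + 2 * (y - y′) + + 1) + + 1
      split = solve-∀

    descLevel-< : ∀ h h′ → slot h < slot h′ → descLevel h < descLevel h′
    descLevel-< h h′ lt = <-by-slack _ (times 2 (nonNeg-gap lt) ⊕ nonNeg 1) (split (+ n) (slot h) (slot h′))
      where
      split : ∀ n P P′ → + 2 * P′ + + 4 * n + + 2 ≡ (+ 2 * P + + 4 * n + + 2) + (+ 2 * (P′ - P - + 1) + + 1) + + 1
      split = solve-∀

    ascLevel-injective : ∀ h h′ → ascLevel h ≡ ascLevel h′ → h ≡ h′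
    ascLevel-injective h h′ eq with ℤₚ.<-cmp (slot h) (slot h′)
    ... | tri< lt _ _ = ⊥-elim (ℤₚ.<⇒≢ (ascLevel-< h h′ lt) eq)
    ... | tri≈ _ slots≡ _ = slot-injective h h′ slots≡
    ... | tri> _ _ gt = ⊥-elim (ℤₚ.<⇒≢ (ascLevel-< h′ h gt) (sym eq))

    descLevel-injective : ∀ h h′ → descLevel h ≡ descLevel h′ → h ≡ h′
    descLevel-injective h h′ eq with ℤₚ.<-cmp (slot h) (slot h′)
    ... | tri< lt _ _ = ⊥-elim (ℤₚ.<⇒≢ (descLevel-< h h′ lt) eq)
    ... | tri≈ _ slots≡ _ = slot-injective h h′ slots≡
    ... | tri> _ _ gt = ⊥-elim (ℤₚ.<⇒≢ (descLevel-< h′ h gt) (sym eq))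

    -- K exceeds the width of the drawing, so sweep orders points by row first and then from
    -- right to left.
    K : ℤ
    K = + 4 * + m + + 4 * + n + + 1

    0≤K : NonNeg K
    0≤K = times 4 (nonNeg m) ⊕ times 4 (nonNeg n) ⊕ nonNeg 1

    sweep : Point → ℤ
    sweep = lin (- + 1) K

    rowStart : Fin n → ℤ
    rowStart v = K * vy v - vx v - + 1

    rowStart<sweep : ∀ v → rowStart v < sweep (point v)
    rowStart<sweep v = <-by-slack (+ 0) (nonNeg 0) (split (+ m) (+ n) (vx v) (vy v))
      where
      split : ∀ m n x y → (- + 1) * x + (+ 4 * m + + 4 * n + + 1) * y ≡ ((+ 4 * m + + 4 * n + + 1) * y - x - + 1) + + 0 + + 1
      split = solve-∀

    sweep-vertex<fan : ∀ h → sweep (point (endpoint h)) < sweep (fan h)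
    sweep-vertex<fan h = <-by-slack _ (times 2 (slot<2m h) ⊕ 0≤vy-1 v ⊕ 0≤vx-1 v ⊕ nonNeg 3) (split (+ m) (+ n) (slot h) (hx h) (hy h))
      where
      v = endpoint h
      split : ∀ m n P x y → (- + 1) * (+ 2 * P + + 4 * n + + 1 - y) + (+ 4 * m + + 4 * n + + 1) * (y + + 1)
                            ≡ ((- + 1) * x + (+ 4 * m + + 4 * n + + 1) * y) + (+ 2 * (m + m - P - + 1) + (y - + 1) + (x - + 1) + + 3) + + 1
      split = solve-∀

    sweep-vertex≤rowStart : ∀ h v → hy h < vy v → sweep (point (endpoint h)) ≤ rowStart v
    sweep-vertex≤rowStart h v lt =
      ≤-by-slack _ (0≤K ⊛ nonNeg-gap lt ⊕ times 4 (nonNeg m) ⊕ times 3 (nonNeg n) ⊕ 0≤n-vx v ⊕ 0≤vx-1 (endpoint h) ⊕ nonNeg 1)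
        (split (+ m) (+ n) (hx h) (hy h) (vx v) (vy v))
      where
      split : ∀ m n x y x′ y′ → (+ 4 * m + + 4 * n + + 1) * y′ - x′ - + 1
                                ≡ ((- + 1) * x + (+ 4 * m + + 4 * n + + 1) * y)
                                  + ((+ 4 * m + + 4 * n + + 1) * (y′ - y - + 1) + + 4 * m + + 3 * n + (n - x′) + (x - + 1) + + 1)
      split = solve-∀

    sweep-fan≤rowStart : ∀ h v → hy h < vy v → sweep (fan h) ≤ rowStart v
    sweep-fan≤rowStart h v lt =
      ≤-by-slack _ (0≤K ⊛ nonNeg-gap lt ⊕ times 2 (0≤slot h) ⊕ times 2 (nonNeg n) ⊕ 0≤n-vy (endpoint h) ⊕ 0≤n-vx v)
        (split (+ m) (+ n) (slot h) (hy h) (vx v) (vy v))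
      where
      split : ∀ m n P y x′ y′ → (+ 4 * m + + 4 * n + + 1) * y′ - x′ - + 1
                                ≡ ((- + 1) * (+ 2 * P + + 4 * n + + 1 - y) + (+ 4 * m + + 4 * n + + 1) * (y + + 1))
                                  + ((+ 4 * m + + 4 * n + + 1) * (y′ - y - + 1) + + 2 * P + + 2 * n + (n - y) + (n - x′))
      split = solve-∀

    sweep-fan-same-row : ∀ h h′ → hy h ≡ hy h′ → slot h′ < slot h → sweep (fan h) < sweep (fan h′)
    sweep-fan-same-row h h′ rows≡ lt =
      subst (λ y → sweep (fan h) < (- + 1) * (+ 2 * slot h′ + + 4 * + n + + 1 - y) + K * (y + + 1)) rows≡
        (<-by-slack _ (times 2 (nonNeg-gap lt) ⊕ nonNeg 1) (split (+ m) (+ n) (slot h) (slot h′) (hy h)))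
      where
      split : ∀ m n P P′ y → (- + 1) * (+ 2 * P′ + + 4 * n + + 1 - y) + (+ 4 * m + + 4 * n + + 1) * (y + + 1)
                             ≡ ((- + 1) * (+ 2 * P + + 4 * n + + 1 - y) + (+ 4 * m + + 4 * n + + 1) * (y + + 1)) + (+ 2 * (P - P′ - + 1) + + 1) + + 1
      split = solve-∀

    sweep-fan<apex : ∀ h e → hy h ≤ vy (upper e) → sweep (fan h) < sweep (apex e)
    sweep-fan<apex h e le =
      <-by-slack _ (0≤K ⊛ ℤₚ.i≤j⇒0≤j-i le ⊕ 0≤K ⊛ 0≤slotGap e ⊕ slot<2m (upperHalf e) ⊕ slot<2m (lowerHalf e) ⊕ 0≤vy-1 (upper e)
                    ⊕ nonNeg 3 ⊕ times 2 (0≤slot h) ⊕ times 3 (nonNeg n) ⊕ 0≤n-vy (endpoint h))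
        (split (+ m) (+ n) (slot h) (hy h) (slot (upperHalf e)) (slot (lowerHalf e)) (vy (upper e)))
      where
      split : ∀ m n P y Pa Pb yu →
        (- + 1) * (Pa + Pb + + 4 * n + + 1 - yu) + (+ 4 * m + + 4 * n + + 1) * (yu + + 1 + Pb - Pa)
        ≡ ((- + 1) * (+ 2 * P + + 4 * n + + 1 - y) + (+ 4 * m + + 4 * n + + 1) * (y + + 1))
          + ((+ 4 * m + + 4 * n + + 1) * (yu - y) + (+ 4 * m + + 4 * n + + 1) * (Pb - Pa - + 1) + (m + m - Pa - + 1)
             + (m + m - Pb - + 1) + (yu - + 1) + + 3 + + 2 * P + + 3 * n + (n - y)) + + 1
      split = solve-∀

    vertex-height≤ : ∀ v → height (point v) ≤ vy v
    vertex-height≤ v = ≤-by-slack (+ 0) (nonNeg 0) (split (vx v) (vy v))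
      where
      split : ∀ x y → y ≡ (+ 0 * x + + 1 * y) + + 0
      split = solve-∀

    vertex-height-below : ∀ h y → hy h < y → height (point (endpoint h)) ≤ y
    vertex-height-below h y lt = ℤₚ.<⇒≤ (<-by-slack _ (nonNeg-gap lt) (split (hx h) (hy h) y))
      where
      split : ∀ x y L → L ≡ (+ 0 * x + + 1 * y) + (L - y - + 1) + + 1
      split = solve-∀

    fan-height-below : ∀ h y → hy h < y → height (fan h) ≤ y
    fan-height-below h y lt = ≤-by-slack _ (nonNeg-gap lt) (split (fanX h) (hy h) y)
      where
      split : ∀ x y L → L ≡ (+ 0 * x + + 1 * (y + + 1)) + (L - y - + 1)
      split = solve-∀

    vertex-height-above : ∀ h y → y < hy h → y < height (point (endpoint h))
    vertex-height-above h y lt = <-by-slack _ (nonNeg-gap lt) (split (hx h) (hy h) y)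
      where
      split : ∀ x y L → + 0 * x + + 1 * y ≡ L + (y - L - + 1) + + 1
      split = solve-∀

    fan-height-above : ∀ h y → y ≤ hy h → y < height (fan h)
    fan-height-above h y le = <-by-slack _ (ℤₚ.i≤j⇒0≤j-i le) (split (fanX h) (hy h) y)
      where
      split : ∀ x y L → + 0 * x + + 1 * (y + + 1) ≡ L + (y - L) + + 1
      split = solve-∀

    apex-height-above-upper : ∀ e → vy (upper e) < height (apex e)
    apex-height-above-upper e =
      <-by-slack _ (0≤slotGap e ⊕ nonNeg 1) (split (X (apex e)) (vy (upper e)) (slot (upperHalf e)) (slot (lowerHalf e)))
      where
      split : ∀ x yu Pa Pb → + 0 * x + + 1 * (yu + + 1 + Pb - Pa) ≡ yu + ((Pb - Pa - + 1) + + 1) + + 1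
      split = solve-∀

    apex-height-above-lower : ∀ e → vy (lower e) < height (apex e)
    apex-height-above-lower e =
      <-by-slack _ (0≤rowGap e ⊕ 0≤slotGap e ⊕ nonNeg 2)
        (split (X (apex e)) (vy (upper e)) (vy (lower e)) (slot (upperHalf e)) (slot (lowerHalf e)))
      where
      split : ∀ x yu yl Pa Pb → + 0 * x + + 1 * (yu + + 1 + Pb - Pa) ≡ yl + ((yu - yl - + 1) + (Pb - Pa - + 1) + + 2) + + 1
      split = solve-∀

    fan-right-of-grid : ∀ h → + n < width (fan h)
    fan-right-of-grid h = <-by-slack _ (times 2 (0≤slot h) ⊕ times 2 (nonNeg n) ⊕ 0≤n-vy (endpoint h)) (split (+ n) (slot h) (hy h))
      where
      split : ∀ n P y → + 1 * (+ 2 * P + + 4 * n + + 1 - y) + + 0 * (y + + 1) ≡ n + (+ 2 * P + + 2 * n + (n - y)) + + 1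
      split = solve-∀

    apex-right-of-grid : ∀ e → + n < width (apex e)
    apex-right-of-grid e =
      <-by-slack _ (0≤slot (upperHalf e) ⊕ 0≤slot (lowerHalf e) ⊕ times 2 (nonNeg n) ⊕ 0≤n-vy (upper e))
        (split (+ n) (slot (upperHalf e)) (slot (lowerHalf e)) (vy (upper e)))
      where
      split : ∀ n Pa Pb y → + 1 * (Pa + Pb + + 4 * n + + 1 - y) + + 0 * (y + + 1 + Pb - Pa) ≡ n + (Pa + Pb + + 2 * n + (n - y)) + + 1
      split = solve-∀

    vertex-width≤n : ∀ v → width (point v) ≤ + n
    vertex-width≤n v = ≤-by-slack _ (0≤n-vx v) (split (vx v) (vy v) (+ n))
      where
      split : ∀ x y n → n ≡ (+ 1 * x + + 0 * y) + (n - x)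
      split = solve-∀

    fanRun : HalfEdge → ℤ
    fanRun h = fanX h - hx h

    0≤fanRun-1 : ∀ h → NonNeg (fanRun h - + 1)
    0≤fanRun-1 h =
      subst NonNeg (sym (split (+ n) (slot h) (hy h) (hx h)))
        (times 2 (0≤slot h) ⊕ times 2 (0≤vx-1 v) ⊕ times 2 (0≤n-vx v) ⊕ 0≤n-vy v ⊕ 0≤n-vx v ⊕ nonNeg 2)
      where
      v = endpoint h
      split : ∀ n P y x → (+ 2 * P + + 4 * n + + 1 - y) - x - + 1 ≡ + 2 * P + + 2 * (x - + 1) + + 2 * (n - x) + (n - y) + (n - x) + + 2
      split = solve-∀

    0≤fanRun : ∀ h → NonNeg (fanRun h)
    0≤fanRun h = subst NonNeg (minus-plus (fanRun h)) (0≤fanRun-1 h ⊕ nonNeg 1)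
      where
      minus-plus : ∀ r → r - + 1 + + 1 ≡ r
      minus-plus = solve-∀

    fanLine : HalfEdge → Point → ℤ
    fanLine h = lin (+ 1) (- fanRun h)

    fanLevel : HalfEdge → ℤ
    fanLevel h = hx h - fanRun h * hy h

    vertex-on-fanLine : ∀ h → fanLine h (point (endpoint h)) ≡ fanLevel h
    vertex-on-fanLine h = identity (hx h) (hy h) (fanRun h)
      where
      identity : ∀ x y r → + 1 * x + (- r) * y ≡ x - r * y
      identity = solve-∀

    fan-on-fanLine : ∀ h → fanLine h (fan h) ≡ fanLevel h
    fan-on-fanLine h = identity (hx h) (hy h) (fanX h)
      where
      identity : ∀ x y X → + 1 * X + (- (X - x)) * (y + + 1) ≡ x - (X - x) * y
      identity = solve-∀

    -- Two fan points in one row differ in x by twice their slot difference, so no other fan point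
    -- of the same vertex lies on the fan line.
    other-fan-off-fanLine : ∀ h h′ → endpoint h ≡ endpoint h′ → h ≢ h′ → fanLine h (fan h′) ≢ fanLevel h
    other-fan-off-fanLine h h′ same ne on = ne (slot-injective h h′ (sym (ℤₚ.i-j≡0⇒i≡j (slot h′) (slot h) slots-diff≡0)))
      where
      y≡ : hy h′ ≡ hy h
      y≡ = cong vy (sym same)
      offset : fanLine h (fan h′) - fanLevel h ≡ + 2 * (slot h′ - slot h)
      offset = subst (λ y → + 1 * (+ 2 * slot h′ + + 4 * + n + + 1 - y) + (- fanRun h) * (y + + 1) - fanLevel h
                             ≡ + 2 * (slot h′ - slot h))
                     (sym y≡) (identity (+ n) (hx h) (hy h) (slot h) (slot h′))
        where
        identity : ∀ n x y P P′ → + 1 * (+ 2 * P′ + + 4 * n + + 1 - y) + (- ((+ 2 * P + + 4 * n + + 1 - y) - x)) * (y + + 1)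
                                  - (x - ((+ 2 * P + + 4 * n + + 1 - y) - x) * y)
                                  ≡ + 2 * (P′ - P)
        identity = solve-∀
      slots-diff≡0 : slot h′ - slot h ≡ + 0
      slots-diff≡0 = ℤₚ.*-cancelˡ-≡ (+ 2) (slot h′ - slot h) (+ 0) (trans (sym offset) (ℤₚ.i≡j⇒i-j≡0 on))

    apex-below-lowerFanLine : ∀ e → fanLine (lowerHalf e) (apex e) < fanLevel (lowerHalf e)
    apex-below-lowerFanLine e =
      <-by-slack _ (0≤fanRun (lowerHalf e) ⊛ (ℤₚ.i≤j⇒0≤j-i (ℤₚ.<⇒≤ (lower<upper e)) ⊕ ℤₚ.i≤j⇒0≤j-i (ℤₚ.<⇒≤ (upperSlot<lowerSlot e)))
                    ⊕ (0≤rowGap e ⊕ 0≤slotGap e ⊕ nonNeg 1))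
        (split (+ n) (vx (lower e)) (vy (lower e)) (vy (upper e)) (slot (upperHalf e)) (slot (lowerHalf e)))
      where
      split : ∀ n x y yu Pa Pb →
        x - ((+ 2 * Pb + + 4 * n + + 1 - y) - x) * y
        ≡ (+ 1 * (Pa + Pb + + 4 * n + + 1 - yu) + (- ((+ 2 * Pb + + 4 * n + + 1 - y) - x)) * (yu + + 1 + Pb - Pa))
          + (((+ 2 * Pb + + 4 * n + + 1 - y) - x) * ((yu - y) + (Pb - Pa)) + ((yu - y - + 1) + (Pb - Pa - + 1) + + 1)) + + 1
      split = solve-∀

    apex-below-upperFanLine : ∀ e → fanLine (upperHalf e) (apex e) < fanLevel (upperHalf e)
    apex-below-upperFanLine e =
      <-by-slack _ (0≤slotGap e ⊛ 0≤fanRun-1 (upperHalf e)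
                    ⊕ (times 2 (0≤slot (upperHalf e)) ⊕ 0≤n-vy u ⊕ 0≤n-vx u ⊕ times 2 (0≤vx-1 u) ⊕ times 2 (0≤n-vx u) ⊕ nonNeg 1))
        (split (+ n) (vx u) (vy u) (slot (upperHalf e)) (slot (lowerHalf e)))
      where
      u = upper e
      split : ∀ n x yu Pa Pb →
        x - ((+ 2 * Pa + + 4 * n + + 1 - yu) - x) * yu
        ≡ (+ 1 * (Pa + Pb + + 4 * n + + 1 - yu) + (- ((+ 2 * Pa + + 4 * n + + 1 - yu) - x)) * (yu + + 1 + Pb - Pa))
          + ((Pb - Pa - + 1) * ((+ 2 * Pa + + 4 * n + + 1 - yu) - x - + 1)
             + (+ 2 * Pa + (n - yu) + (n - x) + + 2 * (x - + 1) + + 2 * (n - x) + + 1)) + + 1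
      split = solve-∀

    vertex≢fan : ∀ h → point (endpoint h) ≢ fan h
    vertex≢fan h eq = ℤₚ.<⇒≢ (<-by-slack (+ 0) (nonNeg 0) (split (hy h))) (cong Y eq)
      where
      split : ∀ y → y + + 1 ≡ y + + 0 + + 1
      split = solve-∀

    upperFan≢apex : ∀ e → fan (upperHalf e) ≢ apex e
    upperFan≢apex e eq =
      ℤₚ.<⇒≢ (<-by-slack _ (0≤slotGap e) (split (slot (upperHalf e)) (slot (lowerHalf e)) (vy (upper e)))) (cong Y eq)
      where
      split : ∀ Pa Pb yu → yu + + 1 + Pb - Pa ≡ (yu + + 1) + (Pb - Pa - + 1) + + 1
      split = solve-∀

    apex≢lowerFan : ∀ e → apex e ≢ fan (lowerHalf e)
    apex≢lowerFan e eq =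
      ℤₚ.<⇒≢ (<-by-slack _ (0≤rowGap e ⊕ 0≤slotGap e ⊕ nonNeg 1)
                (split (slot (upperHalf e)) (slot (lowerHalf e)) (vy (upper e)) (vy (lower e))))
             (sym (cong Y eq))
      where
      split : ∀ Pa Pb yu yl → yu + + 1 + Pb - Pa ≡ (yl + + 1) + ((yu - yl - + 1) + (Pb - Pa - + 1) + + 1) + + 1
      split = solve-∀

    boxWidth boxHeight : ℤ
    boxWidth = + 4 * (+ m + + n)
    boxHeight = + 2 * (+ m + + n)

    InBox₀ : Point → Set
    InBox₀ P = (+ 0 ≤ X P) × (X P ≤ boxWidth) × (+ 0 ≤ Y P) × (Y P ≤ boxHeight)

    vertex-in-box : ∀ v → InBox₀ (point v)
    vertex-in-box v =
      ≤-by-slack _ (0≤vx-1 v ⊕ nonNeg 1) (from-zero (vx v)) ,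
      ≤-by-slack _ (0≤n-vx v ⊕ times 4 (nonNeg m) ⊕ times 3 (nonNeg n)) (split-x (+ m) (+ n) (vx v)) ,
      ≤-by-slack _ (0≤vy-1 v ⊕ nonNeg 1) (from-zero (vy v)) ,
      ≤-by-slack _ (0≤n-vy v ⊕ times 2 (nonNeg m) ⊕ nonNeg n) (split-y (+ m) (+ n) (vy v))
      where
      from-zero : ∀ x → x ≡ + 0 + (x - + 1 + + 1)
      from-zero = solve-∀
      split-x : ∀ m n x → + 4 * (m + n) ≡ x + ((n - x) + + 4 * m + + 3 * n)
      split-x = solve-∀
      split-y : ∀ m n y → + 2 * (m + n) ≡ y + ((n - y) + + 2 * m + n)
      split-y = solve-∀

    fan-in-box : ∀ h → InBox₀ (fan h)
    fan-in-box h =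
      ≤-by-slack _ (times 2 (0≤slot h) ⊕ times 3 (nonNeg n) ⊕ 0≤n-vy v ⊕ nonNeg 1) (split-x₀ (+ n) (slot h) (hy h)) ,
      ≤-by-slack _ (times 2 (slot<2m h) ⊕ 0≤vy-1 v ⊕ nonNeg 2) (split-x₁ (+ m) (+ n) (slot h) (hy h)) ,
      ≤-by-slack _ (0≤vy-1 v ⊕ nonNeg 2) (split-y₀ (hy h)) ,
      ≤-by-slack _ (times 2 (nonNeg m) ⊕ 0≤n-vy v ⊕ 0≤vx-1 v ⊕ 0≤n-vx v) (split-y₁ (+ m) (+ n) (hx h) (hy h))
      where
      v = endpoint h
      split-x₀ : ∀ n P y → (+ 2 * P + + 4 * n + + 1 - y) ≡ + 0 + (+ 2 * P + + 3 * n + (n - y) + + 1)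
      split-x₀ = solve-∀
      split-x₁ : ∀ m n P y → + 4 * (m + n) ≡ (+ 2 * P + + 4 * n + + 1 - y) + (+ 2 * (m + m - P - + 1) + (y - + 1) + + 2)
      split-x₁ = solve-∀
      split-y₀ : ∀ y → y + + 1 ≡ + 0 + ((y - + 1) + + 2)
      split-y₀ = solve-∀
      split-y₁ : ∀ m n x y → + 2 * (m + n) ≡ (y + + 1) + (+ 2 * m + (n - y) + (x - + 1) + (n - x))
      split-y₁ = solve-∀

    apex-in-box : ∀ e → InBox₀ (apex e)
    apex-in-box e =
      ≤-by-slack _ (0≤slot (upperHalf e) ⊕ 0≤slot (lowerHalf e) ⊕ times 3 (nonNeg n) ⊕ 0≤n-vy u ⊕ nonNeg 1) (split-x₀ (+ n) Pa Pb (vy u)) ,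
      ≤-by-slack _ (slot<2m (upperHalf e) ⊕ slot<2m (lowerHalf e) ⊕ 0≤vy-1 u ⊕ nonNeg 2) (split-x₁ (+ m) (+ n) Pa Pb (vy u)) ,
      ≤-by-slack _ (0≤vy-1 u ⊕ 0≤slotGap e ⊕ nonNeg 3) (split-y₀ Pa Pb (vy u)) ,
      ≤-by-slack _ (slot<2m (lowerHalf e) ⊕ 0≤slot (upperHalf e) ⊕ 0≤n-vy u ⊕ 0≤vx-1 u ⊕ 0≤n-vx u ⊕ nonNeg 1)
        (split-y₁ (+ m) (+ n) Pa Pb (vy u) (vx u))
      where
      u = upper e
      Pa = slot (upperHalf e)
      Pb = slot (lowerHalf e)
      split-x₀ : ∀ n Pa Pb y → Pa + Pb + + 4 * n + + 1 - y ≡ + 0 + (Pa + Pb + + 3 * n + (n - y) + + 1)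
      split-x₀ = solve-∀
      split-x₁ : ∀ m n Pa Pb y → + 4 * (m + n) ≡ (Pa + Pb + + 4 * n + + 1 - y) + ((m + m - Pa - + 1) + (m + m - Pb - + 1) + (y - + 1) + + 2)
      split-x₁ = solve-∀
      split-y₀ : ∀ Pa Pb y → y + + 1 + Pb - Pa ≡ + 0 + ((y - + 1) + (Pb - Pa - + 1) + + 3)
      split-y₀ = solve-∀
      split-y₁ : ∀ m n Pa Pb y x → + 2 * (m + n) ≡ (y + + 1 + Pb - Pa) + ((m + m - Pb - + 1) + Pa + (n - y) + (x - + 1) + (n - x) + + 1)
      split-y₁ = solve-∀


    data Piece : Set where
      fanPiece : HalfEdge → Piece
      ascent descent : Fin m → Piece

    start finish : Piece → Point
    start (fanPiece h) = point (endpoint h)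
    start (ascent e) = fan (upperHalf e)
    start (descent e) = apex e
    finish (fanPiece h) = fan h
    finish (ascent e) = apex e
    finish (descent e) = fan (lowerHalf e)

    edgeOf : Piece → Fin m
    edgeOf (fanPiece (e , _)) = e
    edgeOf (ascent e) = e
    edgeOf (descent e) = e

    IsPiece : Piece → Point → Point → Set
    IsPiece k = Traverses (start k) (finish k)

    Disjoint : Piece → Piece → Set
    Disjoint k k′ = ∀ {p q r s a b d} → IsPiece k p q → IsPiece k′ r s → ¬ CommonAt p q r s a b d

    Disjoint-sym : ∀ k k′ → Disjoint k k′ → Disjoint k′ k
    Disjoint-sym k k′ k∩k′≡∅ {p} {q} {r} {s} pq rs ca = k∩k′≡∅ rs pq (CommonAt-sym {p} {q} {r} {s} ca)

    fan-fan-disjoint-< : ∀ h h′ → hy h < hy h′ → Disjoint (fanPiece h) (fanPiece h′)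
    fan-fan-disjoint-< h h′ lt =
      separated⇒¬CommonAt′ (- + 1) K (rowStart v)
        (sweep-vertex≤rowStart h v lt) (sweep-fan≤rowStart h v lt)
        (rowStart<sweep v) (ℤₚ.<-trans (rowStart<sweep v) (sweep-vertex<fan h′))
      where v = endpoint h′

    fan-fan-disjoint : ∀ h h′ → hy h ≢ hy h′ → Disjoint (fanPiece h) (fanPiece h′)
    fan-fan-disjoint h h′ ne with ℤₚ.<-cmp (hy h) (hy h′)
    ... | tri< lt _ _ = fan-fan-disjoint-< h h′ lt
    ... | tri≈ _ eq _ = ⊥-elim (ne eq)
    ... | tri> _ _ gt = Disjoint-sym (fanPiece h′) (fanPiece h) (fan-fan-disjoint-< h′ h gt)

    fan-ascent-disjoint-slot< : ∀ h e → slot h < slot (upperHalf e) → Disjoint (fanPiece h) (ascent e)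
    fan-ascent-disjoint-slot< h e lt =
      separated⇒¬CommonAt′ (+ 1) (- + 1) (ascLevel h)
        (ℤₚ.<⇒≤ (vertex-below-ascLevel h)) (ℤₚ.≤-reflexive (fan-on-ascLevel h))
        (subst (ascLevel h <_) (sym (fan-on-ascLevel (upperHalf e))) (ascLevel-< h (upperHalf e) lt))
        (subst (ascLevel h <_) (sym (apex-on-ascLevel e)) (ascLevel-< h (upperHalf e) lt))

    fan-ascent-disjoint : ∀ h e → h ≢ upperHalf e → Disjoint (fanPiece h) (ascent e)
    fan-ascent-disjoint h e ne with ℤₚ.<-cmp (hy h) (vy (upper e))
    ... | tri< lt _ _ =
      separated⇒¬CommonAt′ (+ 0) (+ 1) (vy (upper e)) (vertex-height-below h _ lt) (fan-height-below h _ lt)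
        (fan-height-above (upperHalf e) _ ℤₚ.≤-refl) (apex-height-above-upper e)
    ... | tri> _ _ gt = fan-ascent-disjoint-slot< h e (higher⇒smaller-slot h (upperHalf e) gt)
    ... | tri≈ _ same-row _ with ℤₚ.<-cmp (slot h) (slot (upperHalf e))
    ...   | tri< lt _ _ = fan-ascent-disjoint-slot< h e lt
    ...   | tri≈ _ slots≡ _ = ⊥-elim (ne (slot-injective h (upperHalf e) slots≡))
    ...   | tri> _ _ gt =
      separated⇒¬CommonAt′ (- + 1) K (sweep (fan h)) (ℤₚ.<⇒≤ (sweep-vertex<fan h)) ℤₚ.≤-refl
        (sweep-fan-same-row h (upperHalf e) same-row gt) (sweep-fan<apex h e (ℤₚ.≤-reflexive same-row))

    fan-descent-disjoint-slot< : ∀ h e → slot h < slot (lowerHalf e) → Disjoint (fanPiece h) (descent e)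
    fan-descent-disjoint-slot< h e lt =
      separated⇒¬CommonAt′ (+ 1) (+ 1) (descLevel h)
        (ℤₚ.<⇒≤ (vertex-below-descLevel h)) (ℤₚ.≤-reflexive (fan-on-descLevel h))
        (subst (descLevel h <_) (sym (apex-on-descLevel e)) (descLevel-< h (lowerHalf e) lt))
        (subst (descLevel h <_) (sym (fan-on-descLevel (lowerHalf e))) (descLevel-< h (lowerHalf e) lt))

    fan-descent-disjoint : ∀ h e → h ≢ lowerHalf e → Disjoint (fanPiece h) (descent e)
    fan-descent-disjoint h e ne with ℤₚ.<-cmp (hy h) (vy (lower e))
    ... | tri< lt _ _ =
      separated⇒¬CommonAt′ (+ 0) (+ 1) (vy (lower e)) (vertex-height-below h _ lt) (fan-height-below h _ lt)
        (apex-height-above-lower e) (fan-height-above (lowerHalf e) _ ℤₚ.≤-refl)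
    ... | tri> _ _ gt = fan-descent-disjoint-slot< h e (higher⇒smaller-slot h (lowerHalf e) gt)
    ... | tri≈ _ same-row _ with ℤₚ.<-cmp (slot h) (slot (lowerHalf e))
    ...   | tri< lt _ _ = fan-descent-disjoint-slot< h e lt
    ...   | tri≈ _ slots≡ _ = ⊥-elim (ne (slot-injective h (lowerHalf e) slots≡))
    ...   | tri> _ _ gt =
      separated⇒¬CommonAt′ (- + 1) K (sweep (fan h)) (ℤₚ.<⇒≤ (sweep-vertex<fan h)) ℤₚ.≤-refl
        (sweep-fan<apex h e (ℤₚ.≤-trans (ℤₚ.≤-reflexive same-row) (ℤₚ.<⇒≤ (lower<upper e))))
        (sweep-fan-same-row h (lowerHalf e) same-row gt)

    ascent-ascent-disjoint-< : ∀ e f → ascLevel (upperHalf e) < ascLevel (upperHalf f) → Disjoint (ascent e) (ascent f)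
    ascent-ascent-disjoint-< e f lt =
      separated⇒¬CommonAt′ (+ 1) (- + 1) (ascLevel (upperHalf e))
        (ℤₚ.≤-reflexive (fan-on-ascLevel (upperHalf e))) (ℤₚ.≤-reflexive (apex-on-ascLevel e))
        (subst (ascLevel (upperHalf e) <_) (sym (fan-on-ascLevel (upperHalf f))) lt)
        (subst (ascLevel (upperHalf e) <_) (sym (apex-on-ascLevel f)) lt)

    ascent-ascent-disjoint : ∀ e f → e ≢ f → Disjoint (ascent e) (ascent f)
    ascent-ascent-disjoint e f ne with ℤₚ.<-cmp (ascLevel (upperHalf e)) (ascLevel (upperHalf f))
    ... | tri< lt _ _ = ascent-ascent-disjoint-< e f lt
    ... | tri≈ _ eq _ = ⊥-elim (ne (cong proj₁ (ascLevel-injective (upperHalf e) (upperHalf f) eq)))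
    ... | tri> _ _ gt = Disjoint-sym (ascent f) (ascent e) (ascent-ascent-disjoint-< f e gt)

    descent-descent-disjoint-< : ∀ e f → descLevel (lowerHalf e) < descLevel (lowerHalf f) → Disjoint (descent e) (descent f)
    descent-descent-disjoint-< e f lt =
      separated⇒¬CommonAt′ (+ 1) (+ 1) (descLevel (lowerHalf e))
        (ℤₚ.≤-reflexive (apex-on-descLevel e)) (ℤₚ.≤-reflexive (fan-on-descLevel (lowerHalf e)))
        (subst (descLevel (lowerHalf e) <_) (sym (apex-on-descLevel f)) lt)
        (subst (descLevel (lowerHalf e) <_) (sym (fan-on-descLevel (lowerHalf f))) lt)

    descent-descent-disjoint : ∀ e f → e ≢ f → Disjoint (descent e) (descent f)
    descent-descent-disjoint e f ne with ℤₚ.<-cmp (descLevel (lowerHalf e)) (descLevel (lowerHalf f))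
    ... | tri< lt _ _ = descent-descent-disjoint-< e f lt
    ... | tri≈ _ eq _ = ⊥-elim (ne (cong proj₁ (descLevel-injective (lowerHalf e) (lowerHalf f) eq)))
    ... | tri> _ _ gt = Disjoint-sym (descent f) (descent e) (descent-descent-disjoint-< f e gt)

    CrossingAt : Point → Point → Point → Point → ℤ → ℤ → ℤ → Set
    CrossingAt p q r s a b d = (dotDir (p , q) (r , s) ≡ + 0) × (+ 0 < a) × (a < d) × (+ 0 < b) × (b < d)

    -- An ascent and a descent of different edges can only cross, in their relative interiors,
    -- since the end points of each lie off the other's level line.
    ascent-descent-crossing : ∀ e f {p q r s a b d} → e ≢ f → IsPiece (ascent e) p q → IsPiece (descent f) r s →
                              CommonAt p q r s a b d → CrossingAt p q r s a b d
    ascent-descent-crossing e f {p} {q} {r} {s} ne pq rs ca =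
      ascending-descending-perpendicular {p} {q} {r} {s} (Traverses-ascending (ascent-ascending e) pq)
        (Traverses-descending (descent-descending f) rs) ,
      proj₁ a-interior , proj₂ a-interior , proj₁ b-interior , proj₂ b-interior
      where
      a-interior = level-CommonAt-interior′ (+ 1) (+ 1) (descLevel (lowerHalf f))
        (apex-on-descLevel f) (fan-on-descLevel (lowerHalf f))
        (λ eq → upper≢lower (descLevel-injective (upperHalf e) (lowerHalf f) (trans (sym (fan-on-descLevel (upperHalf e))) eq)))
        (λ eq → ne (cong proj₁ (descLevel-injective (lowerHalf e) (lowerHalf f) (trans (sym (apex-on-descLevel e)) eq))))
        pq rs ca
      b-interior = level-CommonAt-interior′ (+ 1) (- + 1) (ascLevel (upperHalf e))
        (fan-on-ascLevel (upperHalf e)) (apex-on-ascLevel e)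
        (λ eq → ne (sym (cong proj₁ (ascLevel-injective (upperHalf f) (upperHalf e) (trans (sym (apex-on-ascLevel f)) eq)))))
        (λ eq → upper≢lower (sym (ascLevel-injective (lowerHalf f) (upperHalf e) (trans (sym (fan-on-ascLevel (lowerHalf f))) eq))))
        rs pq (CommonAt-sym {p} {q} {r} {s} ca)

    Avoids : Piece → Point → Set
    Avoids k P = ∀ {p q a d} → IsPiece k p q → ¬ OnSegAt p q a d P

    fan-avoids : ∀ h v → v ≢ endpoint h → Avoids (fanPiece h) (point v)
    fan-avoids h v ne with ℤₚ.<-cmp (hy h) (vy v)
    ... | tri< lt _ _ =
      below⇒¬OnSegAt (- + 1) K (rowStart v) (sweep-vertex≤rowStart h v lt) (sweep-fan≤rowStart h v lt) (rowStart<sweep v)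
    ... | tri≈ _ same-row _ = ⊥-elim (ne (vy-injective v (endpoint h) (sym same-row)))
    ... | tri> _ _ gt =
      above⇒¬OnSegAt (+ 0) (+ 1) (vy v) (vertex-height-above h _ gt) (fan-height-above h _ (ℤₚ.<⇒≤ gt)) (vertex-height≤ v)

    ascent-avoids : ∀ e v → Avoids (ascent e) (point v)
    ascent-avoids e v = above⇒¬OnSegAt (+ 1) (+ 0) (+ n) (fan-right-of-grid (upperHalf e)) (apex-right-of-grid e) (vertex-width≤n v)

    descent-avoids : ∀ e v → Avoids (descent e) (point v)
    descent-avoids e v = above⇒¬OnSegAt (+ 1) (+ 0) (+ n) (apex-right-of-grid e) (fan-right-of-grid (lowerHalf e)) (vertex-width≤n v)

    fans-meet-at-endpoint : ∀ h h′ {p q r s a b d} → endpoint h ≡ endpoint h′ → h ≢ h′ →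
                            IsPiece (fanPiece h) p q → IsPiece (fanPiece h′) r s →
                            CommonAt p q r s a b d → OnSegAt p q a d (point (endpoint h))
    fans-meet-at-endpoint h h′ {r = r} {s} same ne pq rs =
      level-shared-endpoint (+ 1) (- fanRun h) (fanLevel h) (vertex-on-fanLine h) (fan-on-fanLine h)
        (other-fan-off-fanLine h h′ same ne) pq (subst (λ v → Traverses (point v) (fan h′) r s) (sym same) rs)

    Allowed : Fin m → Fin m → Point → Point → Point → Point → ℤ → ℤ → ℤ → Set
    Allowed e f p q r s a b d =
      CrossingAt p q r s a b d ⊎ (∃ λ w → Incident G w e × Incident G w f × OnSegAt p q a d (point w))

    fans-allowed : ∀ h h′ {p q r s a b d} → Dec (hy h ≡ hy h′) → proj₁ h ≢ proj₁ h′ →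
                   IsPiece (fanPiece h) p q → IsPiece (fanPiece h′) r s →
                   CommonAt p q r s a b d → Allowed (proj₁ h) (proj₁ h′) p q r s a b d
    fans-allowed h h′ (yes same-row) ne pq rs ca =
      inj₂ (endpoint h , endpoint-incident h , subst (λ v → Incident G v (proj₁ h′)) (sym same) (endpoint-incident h′) ,
            fans-meet-at-endpoint h h′ same (λ h≡h′ → ne (cong proj₁ h≡h′)) pq rs ca)
      where same = vy-injective (endpoint h) (endpoint h′) same-row
    fans-allowed h h′ (no rows≢) ne pq rs ca = ⊥-elim (fan-fan-disjoint h h′ rows≢ pq rs ca)

    CrossingAt-sym : ∀ {p q r s a b d} → CrossingAt r s p q b a d → CrossingAt p q r s a b d
    CrossingAt-sym {p} {q} {r} {s} (dot≡0 , 0<b , b<d , 0<a , a<d) =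
      trans (dotDir-comm (p , q) (r , s)) dot≡0 , 0<a , a<d , 0<b , b<d

    pieces-allowed : ∀ k k′ {p q r s a b d} → edgeOf k ≢ edgeOf k′ → IsPiece k p q → IsPiece k′ r s →
                     CommonAt p q r s a b d → Allowed (edgeOf k) (edgeOf k′) p q r s a b d
    pieces-allowed (fanPiece h) (fanPiece h′) ne pq rs ca = fans-allowed h h′ (hy h ℤₚ.≟ hy h′) ne pq rs ca
    pieces-allowed (fanPiece h) (ascent f) ne pq rs ca =
      ⊥-elim (fan-ascent-disjoint h f (λ h≡ → ne (cong proj₁ h≡)) pq rs ca)
    pieces-allowed (fanPiece h) (descent f) ne pq rs ca =
      ⊥-elim (fan-descent-disjoint h f (λ h≡ → ne (cong proj₁ h≡)) pq rs ca)
    pieces-allowed (ascent e) (fanPiece h′) ne pq rs ca =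
      ⊥-elim (Disjoint-sym (fanPiece h′) (ascent e) (fan-ascent-disjoint h′ e (λ h≡ → ne (sym (cong proj₁ h≡)))) pq rs ca)
    pieces-allowed (ascent e) (ascent f) ne pq rs ca = ⊥-elim (ascent-ascent-disjoint e f ne pq rs ca)
    pieces-allowed (ascent e) (descent f) ne pq rs ca = inj₁ (ascent-descent-crossing e f ne pq rs ca)
    pieces-allowed (descent e) (fanPiece h′) ne pq rs ca =
      ⊥-elim (Disjoint-sym (fanPiece h′) (descent e) (fan-descent-disjoint h′ e (λ h≡ → ne (sym (cong proj₁ h≡)))) pq rs ca)
    pieces-allowed (descent e) (ascent f) {p} {q} {r} {s} ne pq rs ca =
      inj₁ (CrossingAt-sym {p} {q} {r} {s} (ascent-descent-crossing f e (λ f≡e → ne (sym f≡e)) rs pq (CommonAt-sym {p} {q} {r} {s} ca)))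
    pieces-allowed (descent e) (descent f) ne pq rs ca = ⊥-elim (descent-descent-disjoint e f ne pq rs ca)

    piece-nondegenerate : ∀ k → start k ≢ finish k
    piece-nondegenerate (fanPiece h) = vertex≢fan h
    piece-nondegenerate (ascent e) = upperFan≢apex e
    piece-nondegenerate (descent e) = apex≢lowerFan e

    piece-avoids : ∀ k w → ¬ Incident G w (edgeOf k) → Avoids k (point w)
    piece-avoids (fanPiece h) w ¬inc = fan-avoids h w (λ w≡ → ¬inc (subst (λ v → Incident G v (proj₁ h)) (sym w≡) (endpoint-incident h)))
    piece-avoids (ascent e) w _ = ascent-avoids e w
    piece-avoids (descent e) w _ = descent-avoids e w

    bendsOf : ∀ e → Orientation e → List Point
    bendsOf e (yes _) = fan (upperHalf e) ∷ apex e ∷ fan (lowerHalf e) ∷ []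
    bendsOf e (no _) = fan (lowerHalf e) ∷ apex e ∷ fan (upperHalf e) ∷ []

    bends : Fin m → List Point
    bends e = bendsOf e (orient e)

    downwardOf upwardOf : ∀ e → Orientation e → List (Point × Point)
    downwardOf e o = (point (upperOf e o) , fan (upperHalf e)) ∷ (fan (upperHalf e) , apex e) ∷
                     (apex e , fan (lowerHalf e)) ∷ (fan (lowerHalf e) , point (lowerOf e o)) ∷ []
    upwardOf e o = (point (lowerOf e o) , fan (lowerHalf e)) ∷ (fan (lowerHalf e) , apex e) ∷
                   (apex e , fan (upperHalf e)) ∷ (fan (upperHalf e) , point (upperOf e o)) ∷ []

    downward upward : Fin m → List (Point × Point)
    downward e = downwardOf e (orient e)
    upward e = upwardOf e (orient e)

    edgeSegs-shape : ∀ e → (edgeSegs G S μ bends e ≡ downward e) ⊎ (edgeSegs G S μ bends e ≡ upward e)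
    edgeSegs-shape e = shape (orient e)
      where
      shape : ∀ o → let σs = segs (point (end₁ e) ∷ (bendsOf e o ++ (point (end₂ e) ∷ [])))
                    in (σs ≡ downwardOf e o) ⊎ (σs ≡ upwardOf e o)
      shape (yes _) = inj₁ refl
      shape (no _) = inj₂ refl

    PieceOf : Fin m → Point → Point → Set
    PieceOf e p q = Σ Piece λ k → edgeOf k ≡ e × IsPiece k p q

    downward-piece : ∀ e {p q} → (p , q) ∈ downward e → PieceOf e p q
    downward-piece e (here refl) = fanPiece (upperHalf e) , refl , inj₁ (refl , refl)
    downward-piece e (there (here refl)) = ascent e , refl , inj₁ (refl , refl)
    downward-piece e (there (there (here refl))) = descent e , refl , inj₁ (refl , refl)
    downward-piece e (there (there (there (here refl)))) = fanPiece (lowerHalf e) , refl , inj₂ (refl , refl)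

    upward-piece : ∀ e {p q} → (p , q) ∈ upward e → PieceOf e p q
    upward-piece e (here refl) = fanPiece (lowerHalf e) , refl , inj₁ (refl , refl)
    upward-piece e (there (here refl)) = descent e , refl , inj₂ (refl , refl)
    upward-piece e (there (there (here refl))) = ascent e , refl , inj₂ (refl , refl)
    upward-piece e (there (there (there (here refl)))) = fanPiece (upperHalf e) , refl , inj₂ (refl , refl)

    segment-piece : ∀ e {p q} → (p , q) ∈ edgeSegs G S μ bends e → PieceOf e p q
    segment-piece e {p} {q} pq∈ with edgeSegs-shape e
    ... | inj₁ eq = downward-piece e (subst ((p , q) ∈_) eq pq∈)
    ... | inj₂ eq = upward-piece e (subst ((p , q) ∈_) eq pq∈)

    downward-simple : ∀ e → SimpleChain (downward e)
    downward-simple e =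
      simpleChain₄ (point (upper e)) (fan a) (apex e) (fan b) (point (lower e))
        (level-joint (+ 1) (- + 1) (ascLevel a) (point (upper e)) (fan a) (apex e)
          (ℤₚ.<⇒≢ (vertex-below-ascLevel a)) (fan-on-ascLevel a) (apex-on-ascLevel e))
        (level-joint (+ 1) (+ 1) (descLevel b) (fan a) (apex e) (fan b)
          (λ eq → upper≢lower (descLevel-injective a b (trans (sym (fan-on-descLevel a)) eq))) (apex-on-descLevel e) (fan-on-descLevel b))
        (level-joint (+ 1) (- fanRun b) (fanLevel b) (apex e) (fan b) (point (lower e))
          (ℤₚ.<⇒≢ (apex-below-lowerFanLine e)) (fan-on-fanLine b) (vertex-on-fanLine b))
        (fan-descent-disjoint a e upper≢lower (inj₁ (refl , refl)) (inj₁ (refl , refl)))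
        (fan-fan-disjoint a b (λ eq → ℤₚ.<⇒≢ (lower<upper e) (sym eq)) (inj₁ (refl , refl)) (inj₂ (refl , refl)))
        (Disjoint-sym (fanPiece b) (ascent e) (fan-ascent-disjoint b e λ ()) (inj₁ (refl , refl)) (inj₂ (refl , refl)))
      where
      a = upperHalf e
      b = lowerHalf e

    upward-simple : ∀ e → SimpleChain (upward e)
    upward-simple e =
      simpleChain₄ (point (lower e)) (fan b) (apex e) (fan a) (point (upper e))
        (level-joint (+ 1) (+ 1) (descLevel b) (point (lower e)) (fan b) (apex e)
          (ℤₚ.<⇒≢ (vertex-below-descLevel b)) (fan-on-descLevel b) (apex-on-descLevel e))
        (level-joint (+ 1) (- + 1) (ascLevel a) (fan b) (apex e) (fan a)
          (λ eq → upper≢lower (sym (ascLevel-injective b a (trans (sym (fan-on-ascLevel b)) eq)))) (apex-on-ascLevel e) (fan-on-ascLevel a))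
        (level-joint (+ 1) (- fanRun a) (fanLevel a) (apex e) (fan a) (point (upper e))
          (ℤₚ.<⇒≢ (apex-below-upperFanLine e)) (fan-on-fanLine a) (vertex-on-fanLine a))
        (fan-ascent-disjoint b e (λ ()) (inj₁ (refl , refl)) (inj₂ (refl , refl)))
        (fan-fan-disjoint b a (ℤₚ.<⇒≢ (lower<upper e)) (inj₁ (refl , refl)) (inj₂ (refl , refl)))
        (Disjoint-sym (fanPiece a) (descent e) (fan-descent-disjoint a e upper≢lower) (inj₂ (refl , refl)) (inj₂ (refl , refl)))
      where
      a = upperHalf e
      b = lowerHalf e

    edge-simple : ∀ e → SimpleChain (edgeSegs G S μ bends e)
    edge-simple e with edgeSegs-shape e
    ... | inj₁ eq = subst SimpleChain (sym eq) (downward-simple e)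
    ... | inj₂ eq = subst SimpleChain (sym eq) (upward-simple e)

    ≤3-bends : ∀ e → length (bends e) ℕ.≤ 3
    ≤3-bends e = three (orient e)
      where
      three : ∀ o → length (bendsOf e o) ℕ.≤ 3
      three (yes _) = ℕₚ.≤-refl
      three (no _) = ℕₚ.≤-refl

    bends-in-box : ∀ e {P} → P ∈ bends e → InBox₀ P
    bends-in-box e = in-box (orient e)
      where
      in-box : ∀ o {P} → P ∈ bendsOf e o → InBox₀ P
      in-box (yes _) (here refl) = fan-in-box (upperHalf e)
      in-box (yes _) (there (here refl)) = apex-in-box e
      in-box (yes _) (there (there (here refl))) = fan-in-box (lowerHalf e)
      in-box (no _) (here refl) = fan-in-box (lowerHalf e)
      in-box (no _) (there (here refl)) = apex-in-box e
      in-box (no _) (there (there (here refl))) = fan-in-box (upperHalf e)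

    segments-nondegenerate : ∀ e {p q} → (p , q) ∈ edgeSegs G S μ bends e → p ≢ q
    segments-nondegenerate e pq∈ with segment-piece e pq∈
    ... | k , _ , pq = Traverses-nondegenerate (piece-nondegenerate k) pq

    segments-avoid-vertices : ∀ e w → ¬ Incident G w e → ∀ {p q} → (p , q) ∈ edgeSegs G S μ bends e →
                              ∀ a d → ¬ OnSegAt p q a d (point w)
    segments-avoid-vertices e w ¬inc pq∈ a d with segment-piece e pq∈
    ... | k , refl , pq = piece-avoids k w ¬inc pq

    segments-allowed : ∀ e f → e ≢ f → ∀ {p q r s} → (p , q) ∈ edgeSegs G S μ bends e → (r , s) ∈ edgeSegs G S μ bends f →
                       ∀ a b d → CommonAt p q r s a b d → Allowed e f p q r s a b d
    segments-allowed e f e≢f pq∈ rs∈ a b d ca with segment-piece e pq∈ | segment-piece f rs∈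
    ... | k , refl , pq | k′ , refl , rs = pieces-allowed k k′ e≢f pq rs ca

    drawing : IsRAC3Drawing G S μ bends
    drawing = record
      { atMost3Bends = ≤3-bends
      ; nondegenerate = segments-nondegenerate
      ; avoidsVertices = segments-avoid-vertices
      ; simpleChain = edge-simple
      ; racCrossings = segments-allowed
      }

    area : AreaAtMost G S μ bends (8 ℕ.* (n ℕ.+ m) ℕ.^ 2)
    area = + 0 , boxWidth , + 0 , boxHeight , vertex-in-box , bends-in-box , ℕₚ.≤-reflexive box-area
      where
      side : ∀ k → ∣ + k * (+ m + + n) - + 0 ∣ ≡ k ℕ.* (m ℕ.+ n)
      side k = cong ∣_∣ (trans (ℤₚ.+-identityʳ (+ k * (+ m + + n))) (sym (ℤₚ.pos-* k (m ℕ.+ n))))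
      box-area : ∣ boxWidth - + 0 ∣ ℕ.* ∣ boxHeight - + 0 ∣ ≡ 8 ℕ.* (n ℕ.+ m) ℕ.^ 2
      box-area = trans (cong₂ ℕ._*_ (side 4) (side 2)) (product m n)
        where
        product : ∀ m n → 4 ℕ.* (m ℕ.+ n) ℕ.* (2 ℕ.* (m ℕ.+ n)) ≡ 8 ℕ.* ((n ℕ.+ m) ℕ.* ((n ℕ.+ m) ℕ.* 1))
        product = ℕ-Solver.solve-∀

open import Data.Nat using (ℕ; _+_; _*_; _^_)
open import Data.Fin using (Fin)
open import Data.List using (List)
open import Data.Product using (∃; _×_; _,_; proj₁)
open import Relation.Binary.PropositionalEquality using (_≡_)
open import Function.Definitions using (Bijective)

theorem6 : ∃ λ (c : ℕ) → ∀ (n m : ℕ) (G : Graph n m) (S : Fin n → Point) → IsGridPointSet n S →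
    ∀ (μ : Fin n → Fin n) → Bijective _≡_ _≡_ μ →
    ∃ λ (bends : Fin m → List Point) →
    IsRAC3Drawing G S μ bends × AreaAtMost G S μ bends (c * (n + m) ^ 2)
theorem6 = 8 , λ n m G S grid μ μ-bijective →
  let open RACDrawing.Construction G S grid μ (proj₁ μ-bijective) in bends , drawing , area
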